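{- Let $M=(V,E,B)$ be a reflection complex in $\mathcal{C}$. Then for every edge $K\in E$, the sub-$b$-hypergraph of $M$ on $K$ is thick. In particular $M$ is a thick reflection complex (and its frame is a thick graph).
   Context: A $b$-hypergraph is $M=(V,E,B)$ with $V$ finite, $E\subseteq 2^V$, $B\subseteq 2^V\times2^V$ symmetric; the sub-$b$-hypergraph on $W\subseteq V$ is $(W,\{L\in E:L\subseteq W\},B\cap(2^W\times2^W))$. For $L\in E$, $X\subseteq L$: $r_{L,X}(M)$ has vertex set $V'$ = disjoint union of $V$ and $L$ with the two copies of each $x\in X$ identified (injections $\tau_1:V\to V'$, $\tau_2:L\to V'$); edges $\tau_1(K)$ ($K\in E$), $\tau_2(K)$ ($K\in E,K\subseteq L$), and $\tau_1(K_1)\cup\tau_2(K_2)$ for all $K_1,K_2\in E$ with $K_2\subseteq L$, $X\subseteq K_1\cap K_2$; relation: $\tau_1$-images of pairs in $B$, $\tau_2$-images of pairs in $B\cap(2^L\times2^L)$, and the pairs $(\tau_1(K_1),\tau_2(K_2))$ (and reverses) for such $K_1,K_2$. A reflection complex is obtained from $(\{1,2\},\{\{1,2\}\},\emptyset)$ by finitely many operations $r_{L,X}$. The frame $\mathcal{F}(M)$ is the graph on $V$ whose edges are the $2$-element members of $E$. $\mathcal{C}$ is the set of reflection complexes obtainable from the trivial one by a sequence of operations $N\mapsto r_{L,X}(N)$ in which $X$ spans a forest in $\mathcal{F}(N)$. Thickness: in $\mathbb{R}^{2^V}$, $1_S$ is the indicator of the subset $S$; $t_{A,B}=1_{A\cup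 B}-1_A-1_B+1_{A\cap B}$; $W_B=\mathrm{span}\{t_{A,B}:(A,B)\in B\}$; $Q_V=\mathbb{R}1_\emptyset+$ the cone of nonnegative combinations of all $t_{A,B}$ and $1_A$. For a graph $H$ on $V$ and $X\subseteq V$, $h_H(X)=-1_X+\sum_{e\in E(F)}1_e-\sum_{v\in X}(\deg_F(v)-1)1_{\{v\}}$ with $F$ the subgraph spanned by $X$. A $b$-hypergraph $(V,E,B)$ with frame $H$ is thick if $h_H(V)\in W_B+Q_V$; a thick graph is the frame of a thick reflection complex. -}

module Defs where

open import Data.Nat using (ℕ; zero; suc)
import Data.Nat
open import Data.Bool using (Bool; true; false; if_then_else_; _∧_)
import Data.Bool as Bool
open import Data.Fin using (Fin; zero; suc)
import Data.Fin as Fin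
open import Data.Fin.Subset using (Subset; _∈_; _⊆_; _∪_; _∩_; ⁅_⁆; ∣_∣; ⊤; ⊥)
open import Data.Fin.Subset.Properties using (_∈?_; _⊆?_)
open import Data.Fin.Properties using (any?)
open import Data.Vec using (Vec; tabulate)
import Data.Vec.Properties as VecP
open import Data.List using (List; []; _∷_)
open import Data.List.Membership.Propositional renaming (_∈_ to _∈ₗ_)
import Data.List.Membership.DecPropositional as DecMem
open import Data.List.Relation.Unary.All using (All)
open import Data.List.Relation.Unary.Unique.Propositional using (Unique)
open import Data.Product using (Σ; ∃; _×_; _,_)
open import Data.Sum using (_⊎_)
open import Data.Empty using () renaming (⊥ to Empty)
open import Data.Unit using () renaming (⊤ to Unit)
open import Relation.Nullary using (¬_; Dec; yes; no; _×-dec_)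
open import Relation.Nullary.Decidable using (⌊_⌋)
open import Relation.Binary.PropositionalEquality using (_≡_; _≢_)
open import Function.Bundles using (_⇔_)
open import Data.Rational using (ℚ; 0ℚ; 1ℚ; _+_; _*_; -_; _≤_)
import Data.Rational as ℚ

_≟ₛ_ : ∀ {n} (S T : Subset n) → Dec (S ≡ T)
_≟ₛ_ = VecP.≡-dec Bool._≟_

-- A b-hypergraph M = (V, E, B) with V = Fin n.  The finite families
-- E ⊆ 2^V and B ⊆ 2^V × 2^V are given as lists; only list membership
-- matters (duplicates are irrelevant everywhere below).
record BHyp (n : ℕ) : Set where
  constructor bhyp
  field
    edges : List (Subset n)
    rel   : List (Subset n × Subset n)
open BHyp public

Symmetric : ∀ {n} → BHyp n → Set
Symmetric M = ∀ A C → (A , C) ∈ₗ rel M → (C , A) ∈ₗ rel M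

_∈E?_ : ∀ {n} (S : Subset n) (M : BHyp n) → Dec (S ∈ₗ edges M)
S ∈E? M = DecMem._∈?_ _≟ₛ_ S (edges M)

image : ∀ {n m} → (Fin n → Fin m) → Subset n → Subset m
image τ S = tabulate (λ w → ⌊ any? (λ v → (v ∈? S) ×-dec (τ v Fin.≟ w)) ⌋)

-- The vertex set V' of r_{L,X}(N) is the disjoint
-- union of V and L with the two copies of each x ∈ X identified; we allow
-- any concrete realisation of it: V' = Fin m together with maps
-- τ₁ : V → V' and τ₂ (only its restriction to L matters) such that
-- τ₁ is injective, τ₂ is injective on L, τ₁ v = τ₂ l (l ∈ L) iff
-- v = l ∈ X, and V' = τ₁(V) ∪ τ₂(L).

record DisjUnion {n m : ℕ} (L X : Subset n)
                 (τ₁ τ₂ : Fin n → Fin m) : Set where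
  field
    τ₁-inj : ∀ u v → τ₁ u ≡ τ₁ v → u ≡ v
    τ₂-inj : ∀ u v → u ∈ L → v ∈ L → τ₂ u ≡ τ₂ v → u ≡ v
    glue   : ∀ v l → l ∈ L → (τ₁ v ≡ τ₂ l ⇔ (v ≡ l × l ∈ X))
    cover  : ∀ w → (∃ λ v → τ₁ v ≡ w) ⊎ (∃ λ l → l ∈ L × τ₂ l ≡ w)

GoodPair : ∀ {n} → BHyp n → Subset n → Subset n → Subset n → Subset n → Set
GoodPair N L X K₁ K₂ = K₁ ∈ₗ edges N × K₂ ∈ₗ edges N × K₂ ⊆ L × X ⊆ K₁ ∩ K₂

record IsReflection {n m : ℕ} (N : BHyp n) (L X : Subset n)
                    (τ₁ τ₂ : Fin n → Fin m) (M' : BHyp m) : Set where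
  field
    vertices : DisjUnion L X τ₁ τ₂
    edges-spec : ∀ K' → K' ∈ₗ edges M' ⇔
        ( (∃ λ K → K ∈ₗ edges N × K' ≡ image τ₁ K)
        ⊎ (∃ λ K → K ∈ₗ edges N × K ⊆ L × K' ≡ image τ₂ K)
        ⊎ (∃ λ K₁ → ∃ λ K₂ → GoodPair N L X K₁ K₂
                           × K' ≡ image τ₁ K₁ ∪ image τ₂ K₂))
    rel-spec : ∀ A' C' → (A' , C') ∈ₗ rel M' ⇔
        ( (∃ λ A → ∃ λ C → (A , C) ∈ₗ rel N
                         × A' ≡ image τ₁ A × C' ≡ image τ₁ C)
        ⊎ (∃ λ A → ∃ λ C → (A , C) ∈ₗ rel N × A ⊆ L × C ⊆ L
                         × A' ≡ image τ₂ A × C' ≡ image τ₂ C)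
        ⊎ (∃ λ K₁ → ∃ λ K₂ → GoodPair N L X K₁ K₂
              × ((A' ≡ image τ₁ K₁ × C' ≡ image τ₂ K₂)
                ⊎ (A' ≡ image τ₂ K₂ × C' ≡ image τ₁ K₁))))

FrameEdge : ∀ {n} → BHyp n → Fin n → Fin n → Set
FrameEdge M u v = u ≢ v × (⁅ u ⁆ ∪ ⁅ v ⁆) ∈ₗ edges M

Chain : ∀ {n} → BHyp n → List (Fin n) → Set
Chain M []            = Unit
Chain M (u ∷ [])      = Unit
Chain M (u ∷ v ∷ vs)  = FrameEdge M u v × Chain M (v ∷ vs)

lastOf : ∀ {n} → Fin n → List (Fin n) → Fin n
lastOf v []       = v
lastOf v (w ∷ ws) = lastOf w ws

Cycle : ∀ {n} → BHyp n → Subset n → Set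
Cycle {n} M X = Σ (Fin n) λ v₀ → Σ (Fin n) λ v₁ → Σ (Fin n) λ v₂ →
  Σ (List (Fin n)) λ rest →
    All (_∈ X) (v₀ ∷ v₁ ∷ v₂ ∷ rest)
  × Unique (v₀ ∷ v₁ ∷ v₂ ∷ rest)
  × Chain M (v₀ ∷ v₁ ∷ v₂ ∷ rest)
  × FrameEdge M (lastOf v₂ rest) v₀

SpansForest : ∀ {n} → BHyp n → Subset n → Set
SpansForest M X = ¬ Cycle M X

trivialComplex : BHyp 2
trivialComplex = bhyp (⊤ ∷ []) []

data InC : ∀ {n} → BHyp n → Set where
  base : InC trivialComplex
  reflect : ∀ {n m} {N : BHyp n} {M : BHyp m}
            (L X : Subset n) (τ₁ τ₂ : Fin n → Fin m) →
            InC N → L ∈ₗ edges N → X ⊆ L → SpansForest N X →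
            IsReflection N L X τ₁ τ₂ M → InC M

-- Thickness.  Vectors of ℝ^{2^V} are functions Subset n → ℚ.

Vect : ℕ → Set
Vect n = Subset n → ℚ

𝟙 : ∀ {n} → Subset n → Vect n
𝟙 S T = if ⌊ T ≟ₛ S ⌋ then 1ℚ else 0ℚ

t : ∀ {n} → Subset n → Subset n → Vect n
t A C T = 𝟙 (A ∪ C) T - 𝟙 A T - 𝟙 C T + 𝟙 (A ∩ C) T
  where open Data.Rational using (_-_)

sumFin : ∀ {n} → (Fin n → ℚ) → ℚ
sumFin {zero}  f = 0ℚ
sumFin {suc n} f = f zero + sumFin (λ i → f (suc i))

boolℚ : Bool → ℚ
boolℚ true  = 1ℚ
boolℚ false = 0ℚ

frameEdgeIn : ∀ {n} → BHyp n → Subset n → Subset n → Bool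
frameEdgeIn M W T = ⌊ ∣ T ∣ Data.Nat.≟ 2 ⌋ ∧ ⌊ T ⊆? W ⌋ ∧ ⌊ T ∈E? M ⌋

deg : ∀ {n} → BHyp n → Subset n → Fin n → ℚ
deg M W v = sumFin λ u → boolℚ (frameEdgeIn M W (⁅ u ⁆ ∪ ⁅ v ⁆)
                                 ∧ Bool.not ⌊ u Fin.≟ v ⌋)

h : ∀ {n} → BHyp n → Subset n → Vect n
h M W T = (- 𝟙 W T) + boolℚ (frameEdgeIn M W T)
          - sumFin (λ v → boolℚ ⌊ v ∈? W ⌋ * ((deg M W v - 1ℚ) * 𝟙 ⁅ v ⁆ T))
  where open Data.Rational using (_-_)

combT : ∀ {n} → List (ℚ × Subset n × Subset n) → Vect n
combT []                  T = 0ℚ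
combT ((c , A , C) ∷ cs)  T = c * t A C T + combT cs T

comb𝟙 : ∀ {n} → List (ℚ × Subset n) → Vect n
comb𝟙 []              T = 0ℚ
comb𝟙 ((c , A) ∷ cs)  T = c * 𝟙 A T + comb𝟙 cs T

-- The sub-b-hypergraph of M on W is thick:
--   h_H(W) ∈ W_{B|W} + Q_W,
-- where B|W = B ∩ (2^W × 2^W), W_{B|W} = span{t_{A,C} : (A,C) ∈ B|W},
-- Q_W = ℚ·1_∅ + cone{t_{A,C}, 1_A : A, C ⊆ W}.  (ℚ^{2^W} is identified with
-- the functions on 2^V supported on 2^W; all vectors involved are so.)
ThickOn : ∀ {n} → BHyp n → Subset n → Set
ThickOn {n} M W =
  Σ (List (ℚ × Subset n × Subset n)) λ spanPart →
  Σ ℚ λ r →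
  Σ (List (ℚ × Subset n × Subset n)) λ conePartT →
  Σ (List (ℚ × Subset n)) λ conePart𝟙 →
    All (λ { (c , A , C) → (A , C) ∈ₗ rel M × A ⊆ W × C ⊆ W }) spanPart
  × All (λ { (c , A , C) → 0ℚ ≤ c × A ⊆ W × C ⊆ W }) conePartT
  × All (λ { (c , A) → 0ℚ ≤ c × A ⊆ W }) conePart𝟙
  × (∀ T → h M W T ≡ combT spanPart T + (r * 𝟙 ⊥ T
                        + (combT conePartT T + comb𝟙 conePart𝟙 T)))

Thick : ∀ {n} → BHyp n → Set
Thick M = ThickOn M ⊤

module Submission where

-- Write f ∈ Repr M W when f ∈ W_{B|W} + Q_W.  The proof is an induction
-- along the construction of M with the invariant: every edge K satisfies
-- h_K ∈ Repr M K, no edge is a singleton, and V itself is an edge.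
-- The key identity is the splitting  h_W = vertexTerm W + edgeTerm φ_W,
-- where vertexTerm W = -1_W + Σ_{v∈W} 1_{v} depends on W only and
-- edgeTerm φ = φ - Σ_v deg_φ(v) 1_{v} is linear in the frame indicator φ_W.
-- Both terms, and Repr, commute with the pushforward along a map injective
-- on W; this handles the edges τ₁(K) and τ₂(K) of r_{L,X}(N).  For a glued
-- edge K' = τ₁K₁ ∪ τ₂K₂ we have τ₁K₁ ∩ τ₂K₂ = τ₁X, and every frame edge in
-- K' lies in τ₁K₁ or in τ₂K₂ (here no edge being a singleton is used), so
-- inclusion–exclusion gives  h_{K'} = h_{τ₁K₁} + h_{τ₂K₂} - h_{τ₁X} - t_{τ₁K₁,τ₂K₂}.
-- The last term is in W_B as (τ₁K₁, τ₂K₂) ∈ B, and -h_X ∈ Q_X because X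
-- spans a forest: removing a leaf or an isolated vertex changes -h by a
-- single t-vector (and -1_∅), while a graph without such vertices has a cycle.

open import Defs
open import Data.Product using (_×_)
open import Data.Fin.Subset using (Subset)
open import Data.List.Membership.Propositional renaming (_∈_ to _∈ₗ_)

import Data.Vec as V
import Data.Vec.Properties as VP
open import Data.Nat as ℕ using (ℕ; zero; suc)
import Data.Nat.Properties as NP
open import Data.Bool as B using (Bool; true; false; _∧_; _∨_; not)
import Data.Bool.Properties as BP
open import Data.Fin as F using (Fin; zero; suc)
open import Data.Fin.Properties as FP using (any?)
open import Data.Fin.Subset using (_∈_; _⊆_; _∪_; _∩_; ⁅_⁆; ∣_∣; ⊤; ⊥) renaming (_-_ to _∖ₛ_)
open import Data.Fin.Subset.Properties as SP using (_∈?_; _⊆?_)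
open import Data.Product using (Σ; ∃; _,_; proj₁; proj₂)
open import Data.Sum using (_⊎_; inj₁; inj₂) renaming ([_,_] to either)
open import Data.Empty using () renaming (⊥-elim to absurd)
open import Data.Unit using (tt) renaming (⊤ to Unit)
open import Relation.Nullary using (¬_; Dec; yes; no; _×-dec_)
open import Relation.Nullary.Decidable using (⌊_⌋; toWitness; ¬?)
open import Relation.Binary.PropositionalEquality
open import Function.Bundles using (Equivalence)
open import Data.Rational using (ℚ; 0ℚ; 1ℚ; _+_; _*_; -_; _-_; _≤_; _≤?_)
import Data.Rational.Properties as QP
open import Data.Rational.Solver
open +-*-Solver using (solve; _:+_; _:*_; :-_; _:-_; _:=_; con)
open import Data.List using (List; []; _∷_; _++_; map; length)
open import Data.List.Relation.Unary.All as All using (All; []; _∷_)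
import Data.List.Relation.Unary.All.Properties as AllP
open import Data.List.Relation.Unary.Any using (here; there)
open import Data.List.Relation.Unary.AllPairs using ([]; _∷_)
open import Data.List.Relation.Unary.Unique.Propositional using (Unique)
open import Data.List.Membership.Propositional.Properties using (∈-∃++)
import Data.List.Membership.DecPropositional as DMem

memᵇ : ∀ {n} → Subset n → Fin n → Bool
memᵇ = V.lookup

∈⇒memᵇ : ∀ {n} {S : Subset n} {x} → x ∈ S → memᵇ S x ≡ true
∈⇒memᵇ = VP.[]=⇒lookup

memᵇ⇒∈ : ∀ {n} {S : Subset n} {x} → memᵇ S x ≡ true → x ∈ S
memᵇ⇒∈ {S = S} {x} = VP.lookup⇒[]= x S

∉⇒memᵇ : ∀ {n} {S : Subset n} {x} → ¬ x ∈ S → memᵇ S x ≡ false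
∉⇒memᵇ {S = S} {x} nx with memᵇ S x in eq
... | true = absurd (nx (memᵇ⇒∈ eq))
... | false = refl

memᵇ-∪ : ∀ {n} (S T : Subset n) x → memᵇ (S ∪ T) x ≡ memᵇ S x ∨ memᵇ T x
memᵇ-∪ S T x = VP.lookup-zipWith _∨_ x S T

memᵇ-∩ : ∀ {n} (S T : Subset n) x → memᵇ (S ∩ T) x ≡ memᵇ S x ∧ memᵇ T x
memᵇ-∩ S T x = VP.lookup-zipWith _∧_ x S T

memᵇ-⊥ : ∀ {n} (x : Fin n) → memᵇ ⊥ x ≡ false
memᵇ-⊥ {n} x = ∉⇒memᵇ (SP.∉⊥ {n})

memᵇ-⊤ : ∀ {n} (x : Fin n) → memᵇ ⊤ x ≡ true
memᵇ-⊤ x = VP.lookup-replicate x true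

memᵇ-⁅x⁆-self : ∀ {n} (y : Fin n) → memᵇ ⁅ y ⁆ y ≡ true
memᵇ-⁅x⁆-self y = ∈⇒memᵇ (SP.x∈⁅x⁆ y)

memᵇ-⁅x⁆⇒≡ : ∀ {n} {y x : Fin n} → memᵇ ⁅ y ⁆ x ≡ true → x ≡ y
memᵇ-⁅x⁆⇒≡ e = Equivalence.to SP.x∈⁅y⁆⇔x≡y (memᵇ⇒∈ e)

t≢f : true ≢ false
t≢f ()

f≢t : false ≢ true
f≢t ()

bool-ext : ∀ {a b : Bool} → (a ≡ true → b ≡ true) → (b ≡ true → a ≡ true) → a ≡ b
bool-ext {true} {true} f g = refl
bool-ext {true} {false} f g = sym (f refl)
bool-ext {false} {true} f g = g refl
bool-ext {false} {false} f g = refl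

∧-e : ∀ {a b : Bool} → a ∧ b ≡ true → a ≡ true × b ≡ true
∧-e {true} {true} e = refl , refl
∧-e {true} {false} ()
∧-e {false} ()

∧-i : ∀ {a b : Bool} → a ≡ true → b ≡ true → a ∧ b ≡ true
∧-i refl refl = refl

Sub : ∀ {n} → Subset n → Subset n → Set
Sub A W = ∀ x → memᵇ A x ≡ true → memᵇ W x ≡ true

⊆→Sub : ∀ {n} {S T : Subset n} → S ⊆ T → Sub S T
⊆→Sub s x e = ∈⇒memᵇ (s (memᵇ⇒∈ e))

Sub→⊆ : ∀ {n} {S T : Subset n} → Sub S T → S ⊆ T
Sub→⊆ h {x} i = memᵇ⇒∈ (h x (∈⇒memᵇ i))

setext : ∀ {n} {S T : Subset n} → Sub S T → Sub T S → S ≡ T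
setext f g = SP.⊆-antisym (Sub→⊆ f) (Sub→⊆ g)

∪-l : ∀ {n} (A C : Subset n) x → memᵇ A x ≡ true → memᵇ (A ∪ C) x ≡ true
∪-l A C x e rewrite memᵇ-∪ A C x | e = refl

∪-r : ∀ {n} (A C : Subset n) x → memᵇ C x ≡ true → memᵇ (A ∪ C) x ≡ true
∪-r A C x e rewrite memᵇ-∪ A C x | e = BP.∨-zeroʳ (memᵇ A x)

∪-e : ∀ {n} (A C : Subset n) x → memᵇ (A ∪ C) x ≡ true → memᵇ A x ≡ true ⊎ memᵇ C x ≡ true
∪-e A C x e rewrite memᵇ-∪ A C x with memᵇ A x
... | true = inj₁ refl
... | false = inj₂ e

∩-i : ∀ {n} (A C : Subset n) x → memᵇ A x ≡ true → memᵇ C x ≡ true → memᵇ (A ∩ C) x ≡ true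
∩-i A C x e f rewrite memᵇ-∩ A C x | e | f = refl

∩-e : ∀ {n} (A C : Subset n) x → memᵇ (A ∩ C) x ≡ true → memᵇ A x ≡ true × memᵇ C x ≡ true
∩-e A C x e rewrite memᵇ-∩ A C x = ∧-e e

Sub-refl : ∀ {n} {A : Subset n} → Sub A A
Sub-refl x e = e

Sub-trans : ∀ {n} {A B C : Subset n} → Sub A B → Sub B C → Sub A C
Sub-trans f g x e = g x (f x e)

Sub-∪ : ∀ {n} {A C W : Subset n} → Sub A W → Sub C W → Sub (A ∪ C) W
Sub-∪ {A = A} {C} f g x e with ∪-e A C x e
... | inj₁ a = f x a
... | inj₂ c = g x c

Sub-∩ : ∀ {n} {A C W : Subset n} → Sub A W → Sub (A ∩ C) W
Sub-∩ {A = A} {C} f x e = f x (proj₁ (∩-e A C x e))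

Sub-⊥ : ∀ {n} {W : Subset n} → Sub ⊥ W
Sub-⊥ x e = absurd (f≢t (trans (sym (memᵇ-⊥ x)) e))

Sub-⊤ : ∀ {n} {W : Subset n} → Sub W ⊤
Sub-⊤ x e = memᵇ-⊤ x

Sub-⁅x⁆ : ∀ {n} {W : Subset n} {v} → memᵇ W v ≡ true → Sub ⁅ v ⁆ W
Sub-⁅x⁆ {v = v} e x ex with memᵇ-⁅x⁆⇒≡ {y = v} {x = x} ex
... | refl = e

sub-dec : ∀ {n} (A C : Subset n) → Sub A C ⊎ (∃ λ x → memᵇ A x ≡ true × memᵇ C x ≡ false)
sub-dec A C with FP.any? (λ x → (memᵇ A x B.≟ true) ×-dec (memᵇ C x B.≟ false))
... | yes w = inj₂ w
... | no nw = inj₁ (λ x e → BP.¬-not (λ f → nw (x , e , f)))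

-- The reflection realises τ₁(K) and
-- τ₂(K) as 'image'; the maps are only injective on part of the vertex
-- set, so injectivity is always relative to a subset W.

InjOn : ∀ {n m} → (Fin n → Fin m) → Subset n → Set
InjOn τ W = ∀ u v → memᵇ W u ≡ true → memᵇ W v ≡ true → τ u ≡ τ v → u ≡ v

injOn-everywhere : ∀ {n m} (τ : Fin n → Fin m) → (∀ u v → τ u ≡ τ v → u ≡ v) → ∀ W → InjOn τ W
injOn-everywhere τ i W u v _ _ e = i u v e

image-elim : ∀ {n m} (τ : Fin n → Fin m) S w → memᵇ (image τ S) w ≡ true →
  ∃ λ v → memᵇ S v ≡ true × τ v ≡ w
image-elim τ S w e rewrite VP.lookup∘tabulate (λ w → ⌊ any? (λ v → (v ∈? S) ×-dec (τ v F.≟ w)) ⌋) w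
  with any? (λ v → (v ∈? S) ×-dec (τ v F.≟ w))
... | yes (v , i , q) = v , ∈⇒memᵇ i , q
... | no _ = absurd (f≢t e)

image-intro : ∀ {n m} (τ : Fin n → Fin m) S v → memᵇ S v ≡ true →
  memᵇ (image τ S) (τ v) ≡ true
image-intro τ S v e rewrite VP.lookup∘tabulate (λ w → ⌊ any? (λ u → (u ∈? S) ×-dec (τ u F.≟ w)) ⌋) (τ v)
  with any? (λ u → (u ∈? S) ×-dec (τ u F.≟ τ v))
... | yes _ = refl
... | no ne = absurd (ne (v , memᵇ⇒∈ e , refl))

image-mono : ∀ {n m} (τ : Fin n → Fin m) {A B} → Sub A B → Sub (image τ A) (image τ B)
image-mono τ {A} {B} s w e with image-elim τ A w e
... | v , i , refl = image-intro τ B v (s v i)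

image-∪ : ∀ {n m} (τ : Fin n → Fin m) A C → image τ (A ∪ C) ≡ image τ A ∪ image τ C
image-∪ τ A C = setext f g
  where
  f : Sub (image τ (A ∪ C)) (image τ A ∪ image τ C)
  f w e with image-elim τ (A ∪ C) w e
  ... | v , i , refl with ∪-e A C v i
  ... | inj₁ a = ∪-l (image τ A) (image τ C) (τ v) (image-intro τ A v a)
  ... | inj₂ c = ∪-r (image τ A) (image τ C) (τ v) (image-intro τ C v c)

  g : Sub (image τ A ∪ image τ C) (image τ (A ∪ C))
  g w e with ∪-e (image τ A) (image τ C) w e
  ... | inj₁ a = image-mono τ (∪-l A C) w a
  ... | inj₂ c = image-mono τ (∪-r A C) w c

image-∩ : ∀ {n m} (τ : Fin n → Fin m) W → InjOn τ W → ∀ A C → Sub A W → Sub C W →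
  image τ (A ∩ C) ≡ image τ A ∩ image τ C
image-∩ τ W inj A C sa sc = setext f g
  where
  f : Sub (image τ (A ∩ C)) (image τ A ∩ image τ C)
  f w e with image-elim τ (A ∩ C) w e
  ... | v , i , refl = ∩-i (image τ A) (image τ C) (τ v) (image-intro τ A v (proj₁ (∩-e A C v i)))
                                 (image-intro τ C v (proj₂ (∩-e A C v i)))

  g : Sub (image τ A ∩ image τ C) (image τ (A ∩ C))
  g w e with ∩-e (image τ A) (image τ C) w e
  ... | a , c with image-elim τ A w a | image-elim τ C w c
  ... | v , ia , refl | u , ic , q with inj u v (sc u ic) (sa v ia) q
  ... | refl = image-intro τ (A ∩ C) v (∩-i A C v ia ic)

image-⊥ : ∀ {n m} (τ : Fin n → Fin m) → image τ ⊥ ≡ ⊥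
image-⊥ τ = setext empty (Sub-⊥ {W = image τ ⊥})
  where
  empty : Sub (image τ ⊥) ⊥
  empty w e with image-elim τ ⊥ w e
  ... | v , i , _ = absurd (f≢t (trans (sym (memᵇ-⊥ v)) i))

image-⁅x⁆ : ∀ {n m} (τ : Fin n → Fin m) v → image τ ⁅ v ⁆ ≡ ⁅ τ v ⁆
image-⁅x⁆ τ v = setext f g
  where
  f : Sub (image τ ⁅ v ⁆) ⁅ τ v ⁆
  f w e with image-elim τ ⁅ v ⁆ w e
  ... | u , i , refl with memᵇ-⁅x⁆⇒≡ {y = v} {x = u} i
  ... | refl = memᵇ-⁅x⁆-self (τ u)

  g : Sub ⁅ τ v ⁆ (image τ ⁅ v ⁆)
  g w e with memᵇ-⁅x⁆⇒≡ {y = τ v} {x = w} e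
  ... | refl = image-intro τ ⁅ v ⁆ v (memᵇ-⁅x⁆-self v)

image-reflects : ∀ {n m} (τ : Fin n → Fin m) W → InjOn τ W → ∀ A v → Sub A W → memᵇ W v ≡ true →
  memᵇ (image τ A) (τ v) ≡ true → memᵇ A v ≡ true
image-reflects τ W inj A v sa wv e with image-elim τ A (τ v) e
... | u , i , q with inj u v (sa u i) wv q
... | refl = i

image-inj : ∀ {n m} (τ : Fin n → Fin m) W → InjOn τ W → ∀ A C → Sub A W → Sub C W →
  image τ A ≡ image τ C → A ≡ C
image-inj τ W inj A C sa sc eq =
  setext (λ v i → image-reflects τ W inj C v sc (sa v i) (trans (cong (λ X → memᵇ X (τ v)) (sym eq)) (image-intro τ A v i)))
         (λ v i → image-reflects τ W inj A v sa (sc v i) (trans (cong (λ X → memᵇ X (τ v)) eq) (image-intro τ C v i)))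

sum-cong : ∀ {n} {f g : Fin n → ℚ} → (∀ i → f i ≡ g i) → sumFin f ≡ sumFin g
sum-cong {zero} h = refl
sum-cong {suc n} h = cong₂ _+_ (h zero) (sum-cong (λ i → h (suc i)))

sum-+ : ∀ {n} (f g : Fin n → ℚ) → sumFin (λ i → f i + g i) ≡ sumFin f + sumFin g
sum-+ {zero} f g = refl
sum-+ {suc n} f g =
  trans (cong (f zero + g zero +_) (sum-+ (λ i → f (suc i)) (λ i → g (suc i))))
        (solve 4 (λ a b c d → (a :+ b) :+ (c :+ d) := (a :+ c) :+ (b :+ d)) refl
           (f zero) (g zero) (sumFin (λ i → f (suc i))) (sumFin (λ i → g (suc i))))

sum-* : ∀ {n} c (f : Fin n → ℚ) → sumFin (λ i → c * f i) ≡ c * sumFin f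
sum-* {zero} c f = sym (QP.*-zeroʳ c)
sum-* {suc n} c f =
  trans (cong (c * f zero +_) (sum-* c (λ i → f (suc i))))
        (sym (QP.*-distribˡ-+ c (f zero) _))

sum-neg : ∀ {n} (f : Fin n → ℚ) → sumFin (λ i → - f i) ≡ - sumFin f
sum-neg {zero} f = refl
sum-neg {suc n} f =
  trans (cong (- f zero +_) (sum-neg (λ i → f (suc i))))
        (sym (QP.neg-distrib-+ (f zero) _))

sum-- : ∀ {n} (f g : Fin n → ℚ) → sumFin (λ i → f i - g i) ≡ sumFin f - sumFin g
sum-- f g = trans (sum-+ f (λ i → - g i)) (cong (sumFin f +_) (sum-neg g))

sum-0 : ∀ {n} {f : Fin n → ℚ} → (∀ i → f i ≡ 0ℚ) → sumFin f ≡ 0ℚ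
sum-0 {zero} h = refl
sum-0 {suc n} h = cong₂ _+_ (h zero) (sum-0 (λ i → h (suc i)))

sum-δ : ∀ {n} {f : Fin n → ℚ} (i : Fin n) → (∀ j → j ≢ i → f j ≡ 0ℚ) → sumFin f ≡ f i
sum-δ {suc n} {f} zero h =
  trans (cong (f zero +_) (sum-0 (λ j → h (suc j) (λ ())))) (QP.+-identityʳ _)
sum-δ {suc n} {f} (suc i) h =
  trans (cong₂ _+_ (h zero (λ ())) (sum-δ i (λ j ne → h (suc j) (λ e → ne (FP.suc-injective e)))))
        (QP.+-identityˡ _)

sum-swap : ∀ {n m} (f : Fin n → Fin m → ℚ) →
  sumFin (λ i → sumFin (λ j → f i j)) ≡ sumFin (λ j → sumFin (λ i → f i j))
sum-swap {zero} {m} f = sym (sum-0 {m} (λ j → refl))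
sum-swap {suc n} {m} f =
  trans (cong (sumFin (f zero) +_) (sum-swap (λ i → f (suc i))))
        (sym (sum-+ (f zero) (λ j → sumFin (λ i → f (suc i) j))))

memℚ : ∀ {n} → Subset n → Fin n → ℚ
memℚ S x = boolℚ (memᵇ S x)

δ : ∀ {m} → Fin m → Fin m → ℚ
δ a b = boolℚ ⌊ a F.≟ b ⌋

δ-same : ∀ {m} (a : Fin m) → δ a a ≡ 1ℚ
δ-same a with a F.≟ a
... | yes _ = refl
... | no ne = absurd (ne refl)

δ-other : ∀ {m} {a b : Fin m} → a ≢ b → δ a b ≡ 0ℚ
δ-other {a = a} {b} ne with a F.≟ b
... | yes e = absurd (ne e)
... | no _ = refl

sum-δˡ : ∀ {m} (a : Fin m) (f : Fin m → ℚ) → sumFin (λ w → δ a w * f w) ≡ f a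
sum-δˡ a f =
  trans (sum-δ a (λ w ne → trans (cong (_* f w) (δ-other (λ e → ne (sym e)))) (QP.*-zeroˡ (f w))))
        (trans (cong (_* f a) (δ-same a)) (QP.*-identityˡ (f a)))

sum-δʳ : ∀ {m} (a : Fin m) (f : Fin m → ℚ) → sumFin (λ w → δ w a * f w) ≡ f a
sum-δʳ a f =
  trans (sum-δ a (λ w ne → trans (cong (_* f w) (δ-other ne)) (QP.*-zeroˡ (f w))))
        (trans (cong (_* f a) (δ-same a)) (QP.*-identityˡ (f a)))

memℚ-mul-cong : ∀ {n} (W : Subset n) v {x y} → (memᵇ W v ≡ true → x ≡ y) → memℚ W v * x ≡ memℚ W v * y
memℚ-mul-cong W v {x} {y} h with memᵇ W v
... | true = cong (1ℚ *_) (h refl)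
... | false = trans (QP.*-zeroˡ x) (sym (QP.*-zeroˡ y))

memℚ-mul-drop : ∀ {n} (W : Subset n) v {x} → (memᵇ W v ≡ false → x ≡ 0ℚ) → memℚ W v * x ≡ x
memℚ-mul-drop W v {x} h with memᵇ W v
... | true = QP.*-identityˡ x
... | false = trans (QP.*-zeroˡ x) (sym (h refl))

reindex : ∀ {n m} (τ : Fin n → Fin m) (W : Subset n) → InjOn τ W → (f : Fin m → ℚ) →
  sumFin (λ w → memℚ (image τ W) w * f w) ≡ sumFin (λ v → memℚ W v * f (τ v))
reindex {n} {m} τ W inj f = begin
  sumFin (λ w → memℚ (image τ W) w * f w)  ≡⟨ sum-cong image-as-sum ⟩
  sumFin (λ w → sumFin (λ v → term v w))   ≡⟨ sum-swap (λ w v → term v w) ⟩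
  sumFin (λ v → sumFin (λ w → term v w))   ≡⟨ sum-cong collapse ⟩
  sumFin (λ v → memℚ W v * f (τ v))        ∎
  where
  open ≡-Reasoning

  term : Fin n → Fin m → ℚ
  term v w = memℚ W v * (δ (τ v) w * f w)

  term-0 : ∀ v w → (memᵇ W v ≡ true → τ v ≢ w) → term v w ≡ 0ℚ
  term-0 v w ne = trans (memℚ-mul-cong W v (λ wv → trans (cong (_* f w) (δ-other (ne wv))) (QP.*-zeroˡ (f w))))
                        (QP.*-zeroʳ (memℚ W v))

  image-as-sum : ∀ w → memℚ (image τ W) w * f w ≡ sumFin (λ v → term v w)
  image-as-sum w with memᵇ (image τ W) w in eq
  ... | false = trans (QP.*-zeroˡ (f w))
                  (sym (sum-0 (λ v → term-0 v w (λ wv e → t≢f (trans (sym (image-intro τ W v wv))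
                                                                  (trans (cong (memᵇ (image τ W)) e) eq))))))
  ... | true with image-elim τ W w eq
  ... | v₀ , wv₀ , refl = sym (trans (sum-δ v₀ (λ v ne → term-0 v (τ v₀) (λ wv e → ne (inj v v₀ wv wv₀ e))))
                                     (trans (memℚ-mul-drop W v₀ (λ o → absurd (t≢f (trans (sym wv₀) o))))
                                            (cong (_* f (τ v₀)) (δ-same (τ v₀)))))

  collapse : ∀ v → sumFin (λ w → term v w) ≡ memℚ W v * f (τ v)
  collapse v = trans (sum-* (memℚ W v) (λ w → δ (τ v) w * f w)) (cong (memℚ W v *_) (sum-δˡ (τ v) f))

-- For f : 2^V → ℚ "living on W",
-- push τ W f is the function on 2^{V'} with (push τ W f)(τ S) = f S for
-- S ⊆ W, and 0 on sets that are not such images.  When τ is injective on W it is linear,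
-- sends 1_S to 1_{τ S} and t_{A,C} to t_{τA,τC}; this is how every vector
-- attached to N is transported to r_{L,X}(N).

preimage : ∀ {n m} → (Fin n → Fin m) → Subset n → Subset m → Subset n
preimage τ W T' = V.tabulate (λ u → memᵇ W u ∧ memᵇ T' (τ u))

keepIf : Bool → ℚ → ℚ
keepIf true q = q
keepIf false q = 0ℚ

hitsImage : ∀ {n m} → (Fin n → Fin m) → Subset n → Subset m → Bool
hitsImage τ W T' = ⌊ image τ (preimage τ W T') ≟ₛ T' ⌋

push : ∀ {n m} → (Fin n → Fin m) → Subset n → (Subset n → ℚ) → Subset m → ℚ
push τ W f T' = keepIf (hitsImage τ W T') (f (preimage τ W T'))

memᵇ-preimage : ∀ {n m} (τ : Fin n → Fin m) W T' u → memᵇ (preimage τ W T') u ≡ memᵇ W u ∧ memᵇ T' (τ u)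
memᵇ-preimage τ W T' u = VP.lookup∘tabulate _ u

preimage-Sub : ∀ {n m} (τ : Fin n → Fin m) W T' → Sub (preimage τ W T') W
preimage-Sub τ W T' u e = proj₁ (∧-e (trans (sym (memᵇ-preimage τ W T' u)) e))

preimage-image : ∀ {n m} (τ : Fin n → Fin m) W → InjOn τ W → ∀ S → Sub S W → preimage τ W (image τ S) ≡ S
preimage-image τ W inj S sw = setext f g
  where
  f : Sub (preimage τ W (image τ S)) S
  f u e = let (a , b) = ∧-e (trans (sym (memᵇ-preimage τ W (image τ S) u)) e) in
          image-reflects τ W inj S u sw a b

  g : Sub S (preimage τ W (image τ S))
  g u e = trans (memᵇ-preimage τ W (image τ S) u) (∧-i (sw u e) (image-intro τ S u e))

PushCase : ∀ {n m} (τ : Fin n → Fin m) (W : Subset n) (T' : Subset m) → Set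
PushCase {n} τ W T' =
  (Σ (Subset n) λ S → Sub S W × T' ≡ image τ S × (∀ f → push τ W f T' ≡ f S))
  ⊎ ((∀ S → Sub S W → T' ≢ image τ S) × (∀ f → push τ W f T' ≡ 0ℚ))

push-cases : ∀ {n m} (τ : Fin n → Fin m) W → InjOn τ W → ∀ T' → PushCase τ W T'
push-cases τ W inj T' with image τ (preimage τ W T') ≟ₛ T'
... | yes e = inj₁ (preimage τ W T' , preimage-Sub τ W T' , sym e , λ f → refl)
... | no ne = inj₂ ((λ S sw q → ne (trans (cong (image τ) (trans (cong (preimage τ W) q)
                                                          (preimage-image τ W inj S sw))) (sym q))) ,
                    λ f → refl)

push-at-image : ∀ {n m} (τ : Fin n → Fin m) W → InjOn τ W → ∀ S → Sub S W → ∀ f →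
  push τ W f (image τ S) ≡ f S
push-at-image τ W inj S sw f with push-cases τ W inj (image τ S)
... | inj₁ (S0 , s0 , q , h) = trans (h f) (cong f (sym (image-inj τ W inj S S0 sw s0 q)))
... | inj₂ (h , _) = absurd (h S sw refl)

push-zero-outside : ∀ {n m} (τ : Fin n → Fin m) W → InjOn τ W → ∀ g T' v' → memᵇ T' v' ≡ true →
  memᵇ (image τ W) v' ≡ false → push τ W g T' ≡ 0ℚ
push-zero-outside τ W inj g T' v' i o with push-cases τ W inj T'
... | inj₁ (S , sw , refl , h) = absurd (f≢t (trans (sym o) (image-mono τ sw v' i)))
... | inj₂ (_ , z) = z g

keepIf-+ : ∀ b x y → keepIf b (x + y) ≡ keepIf b x + keepIf b y
keepIf-+ true x y = refl
keepIf-+ false x y = refl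

keepIf-neg : ∀ b x → keepIf b (- x) ≡ - keepIf b x
keepIf-neg true x = refl
keepIf-neg false x = refl

keepIf-* : ∀ b c x → keepIf b (c * x) ≡ c * keepIf b x
keepIf-* true c x = refl
keepIf-* false c x = sym (QP.*-zeroʳ c)

keepIf-0 : ∀ b → keepIf b 0ℚ ≡ 0ℚ
keepIf-0 true = refl
keepIf-0 false = refl

keepIf-sum : ∀ {k} b (F : Fin k → ℚ) → keepIf b (sumFin F) ≡ sumFin (λ v → keepIf b (F v))
keepIf-sum true F = refl
keepIf-sum {k} false F = sym (sum-0 {k} (λ v → refl))

push-cong : ∀ {n m} (τ : Fin n → Fin m) W {f g : Subset n → ℚ} → (∀ T → f T ≡ g T) →
  ∀ T' → push τ W f T' ≡ push τ W g T'
push-cong τ W h T' = cong (keepIf (hitsImage τ W T')) (h (preimage τ W T'))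

push-+ : ∀ {n m} (τ : Fin n → Fin m) W (f g : Subset n → ℚ) T' →
  push τ W (λ T → f T + g T) T' ≡ push τ W f T' + push τ W g T'
push-+ τ W f g T' = keepIf-+ (hitsImage τ W T') _ _

push-neg : ∀ {n m} (τ : Fin n → Fin m) W (f : Subset n → ℚ) T' →
  push τ W (λ T → - f T) T' ≡ - push τ W f T'
push-neg τ W f T' = keepIf-neg (hitsImage τ W T') _

push-* : ∀ {n m} (τ : Fin n → Fin m) W c (f : Subset n → ℚ) T' →
  push τ W (λ T → c * f T) T' ≡ c * push τ W f T'
push-* τ W c f T' = keepIf-* (hitsImage τ W T') c _

push-0 : ∀ {n m} (τ : Fin n → Fin m) W T' → push τ W (λ T → 0ℚ) T' ≡ 0ℚ
push-0 τ W T' = keepIf-0 (hitsImage τ W T')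

push-sum : ∀ {n m k} (τ : Fin n → Fin m) W (F : Fin k → Subset n → ℚ) T' →
  push τ W (λ T → sumFin (λ v → F v T)) T' ≡ sumFin (λ v → push τ W (F v) T')
push-sum τ W F T' = keepIf-sum (hitsImage τ W T') (λ v → F v (preimage τ W T'))

push-- : ∀ {n m} (τ : Fin n → Fin m) W (f g : Subset n → ℚ) T' →
  push τ W (λ T → f T - g T) T' ≡ push τ W f T' - push τ W g T'
push-- τ W f g T' = trans (push-+ τ W f (λ T → - g T) T') (cong (push τ W f T' +_) (push-neg τ W g T'))

𝟙-same : ∀ {n} (S : Subset n) → 𝟙 S S ≡ 1ℚ
𝟙-same S with S ≟ₛ S
... | yes _ = refl
... | no ne = absurd (ne refl)

𝟙-diff : ∀ {n} {S T : Subset n} → T ≢ S → 𝟙 S T ≡ 0ℚ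
𝟙-diff {S = S} {T} ne with T ≟ₛ S
... | yes e = absurd (ne e)
... | no _ = refl

push-𝟙 : ∀ {n m} (τ : Fin n → Fin m) W → InjOn τ W → ∀ S → Sub S W → ∀ T' →
  𝟙 (image τ S) T' ≡ push τ W (𝟙 S) T'
push-𝟙 τ W inj S sw T' with push-cases τ W inj T'
... | inj₂ (h , z) = trans (𝟙-diff (λ q → h S sw q)) (sym (z (𝟙 S)))
... | inj₁ (S0 , s0 , refl , h) with S0 ≟ₛ S
... | yes refl = trans (𝟙-same (image τ S)) (sym (trans (h (𝟙 S)) (𝟙-same S)))
... | no ne = trans (𝟙-diff (λ q → ne (image-inj τ W inj S0 S s0 sw q)))
                    (sym (trans (h (𝟙 S)) (𝟙-diff ne)))

-- t_{τA,τC} is the pushforward of t_{A,C} (τ(A ∩ C) = τA ∩ τC needs injectivity).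
push-t : ∀ {n m} (τ : Fin n → Fin m) W → InjOn τ W → ∀ A C → Sub A W → Sub C W → ∀ T' →
  t (image τ A) (image τ C) T' ≡ push τ W (t A C) T'
push-t τ W inj A C sa sc T' = begin
  t (image τ A) (image τ C) T'
    ≡⟨ cong₂ (λ X Y → 𝟙 X T' - 𝟙 (image τ A) T' - 𝟙 (image τ C) T' + 𝟙 Y T')
             (sym (image-∪ τ A C)) (sym (image-∩ τ W inj A C sa sc)) ⟩
  𝟙 (image τ (A ∪ C)) T' - 𝟙 (image τ A) T' - 𝟙 (image τ C) T' + 𝟙 (image τ (A ∩ C)) T'
    ≡⟨ cong₂ _+_ (cong₂ _-_ (cong₂ _-_ (push-𝟙 τ W inj (A ∪ C) (Sub-∪ {A = A} {C} {W} sa sc) T')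
                                       (push-𝟙 τ W inj A sa T'))
                            (push-𝟙 τ W inj C sc T'))
                 (push-𝟙 τ W inj (A ∩ C) (Sub-∩ {A = A} {C} {W} sa) T') ⟩
  push τ W (𝟙 (A ∪ C)) T' - push τ W (𝟙 A) T' - push τ W (𝟙 C) T' + push τ W (𝟙 (A ∩ C)) T'
    ≡⟨ sym (trans (push-+ τ W (λ T → 𝟙 (A ∪ C) T - 𝟙 A T - 𝟙 C T) (𝟙 (A ∩ C)) T')
             (cong (_+ push τ W (𝟙 (A ∩ C)) T')
               (trans (push-- τ W (λ T → 𝟙 (A ∪ C) T - 𝟙 A T) (𝟙 C) T')
                      (cong (_- push τ W (𝟙 C) T') (push-- τ W (𝟙 (A ∪ C)) (𝟙 A) T'))))) ⟩
  push τ W (t A C) T' ∎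
  where open ≡-Reasoning

termA termC : ∀ {n} → ℚ × Subset n × Subset n → Subset n
termA x = proj₁ (proj₂ x)
termC x = proj₂ (proj₂ x)

SpanTerm : ∀ {n} → BHyp n → Subset n → ℚ × Subset n × Subset n → Set
SpanTerm M W x = (termA x , termC x) ∈ₗ rel M × termA x ⊆ W × termC x ⊆ W

ConeTerm : ∀ {n} → Subset n → ℚ × Subset n × Subset n → Set
ConeTerm W x = 0ℚ ≤ proj₁ x × termA x ⊆ W × termC x ⊆ W

ConeIndicator : ∀ {n} → Subset n → ℚ × Subset n → Set
ConeIndicator W y = 0ℚ ≤ proj₁ y × proj₂ y ⊆ W

combination : ∀ {n} → List (ℚ × Subset n × Subset n) → ℚ → List (ℚ × Subset n × Subset n) →
              List (ℚ × Subset n) → Subset n → ℚ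
combination sp r ct c1 T = combT sp T + (r * 𝟙 ⊥ T + (combT ct T + comb𝟙 c1 T))

record Repr {n} (M : BHyp n) (W : Subset n) (f : Subset n → ℚ) : Set where
  constructor repr
  field
    spanPart  : List (ℚ × Subset n × Subset n)
    emptyPart : ℚ
    conePartT : List (ℚ × Subset n × Subset n)
    conePart𝟙 : List (ℚ × Subset n)
    spanOK    : All (SpanTerm M W) spanPart
    coneTOK   : All (ConeTerm W) conePartT
    cone𝟙OK   : All (ConeIndicator W) conePart𝟙
    equation  : ∀ T → f T ≡ combination spanPart emptyPart conePartT conePart𝟙 T

repr⇒thick : ∀ {n} (M : BHyp n) W → Repr M W (h M W) → ThickOn M W
repr⇒thick M W (repr sp r ct c1 a b c e) =
  sp , r , ct , c1 , All.map (λ p → p) a , All.map (λ p → p) b , All.map (λ p → p) c , e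

combT-++ : ∀ {n} (xs ys : List (ℚ × Subset n × Subset n)) T →
  combT (xs ++ ys) T ≡ combT xs T + combT ys T
combT-++ [] ys T = sym (QP.+-identityˡ _)
combT-++ ((c , A , C) ∷ xs) ys T =
  trans (cong (c * t A C T +_) (combT-++ xs ys T)) (sym (QP.+-assoc (c * t A C T) (combT xs T) (combT ys T)))

comb𝟙-++ : ∀ {n} (xs ys : List (ℚ × Subset n)) T →
  comb𝟙 (xs ++ ys) T ≡ comb𝟙 xs T + comb𝟙 ys T
comb𝟙-++ [] ys T = sym (QP.+-identityˡ _)
comb𝟙-++ ((c , A) ∷ xs) ys T =
  trans (cong (c * 𝟙 A T +_) (comb𝟙-++ xs ys T)) (sym (QP.+-assoc (c * 𝟙 A T) (comb𝟙 xs T) (comb𝟙 ys T)))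

combination-++ : ∀ {n} sp r ct c1 sp' r' ct' c1' (T : Subset n) →
  combination (sp ++ sp') (r + r') (ct ++ ct') (c1 ++ c1') T
    ≡ combination sp r ct c1 T + combination sp' r' ct' c1' T
combination-++ sp r ct c1 sp' r' ct' c1' T =
  trans (cong₂ _+_ (combT-++ sp sp' T) (cong ((r + r') * 𝟙 ⊥ T +_)
                                             (cong₂ _+_ (combT-++ ct ct' T) (comb𝟙-++ c1 c1' T))))
        (solve 9 (λ s s' r r' z x x' y y' →
                    (s :+ s') :+ ((r :+ r') :* z :+ ((x :+ x') :+ (y :+ y')))
                 := (s :+ (r :* z :+ (x :+ y))) :+ (s' :+ (r' :* z :+ (x' :+ y')))) refl
           (combT sp T) (combT sp' T) r r' (𝟙 ⊥ T) (combT ct T) (combT ct' T) (comb𝟙 c1 T) (comb𝟙 c1' T))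

repr-ext : ∀ {n} {M : BHyp n} {W} {f g : Subset n → ℚ} → (∀ T → f T ≡ g T) → Repr M W g → Repr M W f
repr-ext h (repr sp r ct c1 a b c e) = repr sp r ct c1 a b c (λ T → trans (h T) (e T))

repr-+ : ∀ {n} {M : BHyp n} {W} {f g : Subset n → ℚ} → Repr M W f → Repr M W g →
  Repr M W (λ T → f T + g T)
repr-+ (repr sp r ct c1 a b c e) (repr sp' r' ct' c1' a' b' c' e') =
  repr (sp ++ sp') (r + r') (ct ++ ct') (c1 ++ c1') (AllP.++⁺ a a') (AllP.++⁺ b b') (AllP.++⁺ c c')
       (λ T → trans (cong₂ _+_ (e T) (e' T)) (sym (combination-++ sp r ct c1 sp' r' ct' c1' T)))

repr-rel : ∀ {n} {M : BHyp n} {W} c A C → (A , C) ∈ₗ rel M → A ⊆ W → C ⊆ W →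
  Repr M W (λ T → c * t A C T)
repr-rel c A C m a b = repr ((c , A , C) ∷ []) 0ℚ [] [] ((m , a , b) ∷ []) [] []
  (λ T → solve 3 (λ x y z → x :* y := x :* y :+ con 0ℚ :+ (con 0ℚ :* z :+ (con 0ℚ :+ con 0ℚ))) refl
                 c (t A C T) (𝟙 ⊥ T))

repr-t : ∀ {n} {M : BHyp n} {W} A C → A ⊆ W → C ⊆ W → Repr M W (t A C)
repr-t A C a b = repr [] 0ℚ ((1ℚ , A , C) ∷ []) [] [] ((0≤1 , a , b) ∷ []) []
  (λ T → solve 2 (λ x z → x := con 0ℚ :+ (con 0ℚ :* z :+ ((con 1ℚ :* x :+ con 0ℚ) :+ con 0ℚ))) refl
                 (t A C T) (𝟙 ⊥ T))
  where 0≤1 : 0ℚ ≤ 1ℚ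
        0≤1 = toWitness {a? = 0ℚ ≤? 1ℚ} tt

repr-∅ : ∀ {n} {M : BHyp n} {W} r → Repr M W (λ T → r * 𝟙 ⊥ T)
repr-∅ r = repr [] r [] [] [] [] [] (λ T → sym (trans (QP.+-identityˡ _) (QP.+-identityʳ _)))

repr-widen : ∀ {n} {M : BHyp n} {W W'} → W ⊆ W' → ∀ {f} → Repr M W f → Repr M W' f
repr-widen {M = M} {W} {W'} ww (repr sp r ct c1 a b c e) =
  repr sp r ct c1 (All.map (λ {x} → span {x}) a) (All.map (λ {x} → coneT {x}) b)
                  (All.map (λ {y} → cone𝟙 {y}) c) e
  where
  span : ∀ {x} → SpanTerm M W x → SpanTerm M W' x
  span (m , x , y) = m , SP.⊆-trans x ww , SP.⊆-trans y ww

  coneT : ∀ {x} → ConeTerm W x → ConeTerm W' x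
  coneT (p , x , y) = p , SP.⊆-trans x ww , SP.⊆-trans y ww

  cone𝟙 : ∀ {y} → ConeIndicator W y → ConeIndicator W' y
  cone𝟙 (p , x) = p , SP.⊆-trans x ww

mapTerms : ∀ {n m} → (Fin n → Fin m) → List (ℚ × Subset n × Subset n) → List (ℚ × Subset m × Subset m)
mapTerms τ = map (λ x → proj₁ x , image τ (termA x) , image τ (termC x))

mapIndicators : ∀ {n m} → (Fin n → Fin m) → List (ℚ × Subset n) → List (ℚ × Subset m)
mapIndicators τ = map (λ y → proj₁ y , image τ (proj₂ y))

TermsIn : ∀ {n} → Subset n → List (ℚ × Subset n × Subset n) → Set
TermsIn W = All (λ x → termA x ⊆ W × termC x ⊆ W)

combT-push : ∀ {n m} (τ : Fin n → Fin m) W → InjOn τ W → ∀ xs → TermsIn W xs → ∀ T' →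
  combT (mapTerms τ xs) T' ≡ push τ W (combT xs) T'
combT-push τ W inj [] [] T' = sym (push-0 τ W T')
combT-push τ W inj ((c , A , C) ∷ xs) ((a , b) ∷ ps) T' =
  trans (cong₂ _+_ (cong (c *_) (push-t τ W inj A C (⊆→Sub a) (⊆→Sub b) T'))
                   (combT-push τ W inj xs ps T'))
   (sym (trans (push-+ τ W (λ T → c * t A C T) (combT xs) T')
               (cong (_+ push τ W (combT xs) T') (push-* τ W c (t A C) T'))))

comb𝟙-push : ∀ {n m} (τ : Fin n → Fin m) W → InjOn τ W → ∀ ys → All (λ y → proj₂ y ⊆ W) ys → ∀ T' →
  comb𝟙 (mapIndicators τ ys) T' ≡ push τ W (comb𝟙 ys) T'
comb𝟙-push τ W inj [] [] T' = sym (push-0 τ W T')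
comb𝟙-push τ W inj ((c , A) ∷ ys) (a ∷ ps) T' =
  trans (cong₂ _+_ (cong (c *_) (push-𝟙 τ W inj A (⊆→Sub a) T'))
                   (comb𝟙-push τ W inj ys ps T'))
   (sym (trans (push-+ τ W (λ T → c * 𝟙 A T) (comb𝟙 ys) T')
               (cong (_+ push τ W (comb𝟙 ys) T') (push-* τ W c (𝟙 A) T'))))

combination-push : ∀ {n m} (τ : Fin n → Fin m) W → InjOn τ W → ∀ sp r ct c1 →
  TermsIn W sp → TermsIn W ct → All (λ y → proj₂ y ⊆ W) c1 → ∀ T' →
  combination (mapTerms τ sp) r (mapTerms τ ct) (mapIndicators τ c1) T' ≡ push τ W (combination sp r ct c1) T'
combination-push τ W inj sp r ct c1 a b c T' = begin
  combination (mapTerms τ sp) r (mapTerms τ ct) (mapIndicators τ c1) T'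
    ≡⟨ cong₂ _+_ (combT-push τ W inj sp a T')
         (cong₂ _+_ (cong (r *_) (trans (cong (λ X → 𝟙 X T') (sym (image-⊥ τ)))
                                        (push-𝟙 τ W inj ⊥ (Sub-⊥ {W = W}) T')))
                    (cong₂ _+_ (combT-push τ W inj ct b T') (comb𝟙-push τ W inj c1 c T'))) ⟩
  push τ W (combT sp) T' + (r * push τ W (𝟙 ⊥) T' + (push τ W (combT ct) T' + push τ W (comb𝟙 c1) T'))
    ≡⟨ sym (trans (push-+ τ W (combT sp) (λ T → r * 𝟙 ⊥ T + (combT ct T + comb𝟙 c1 T)) T')
             (cong (push τ W (combT sp) T' +_)
               (trans (push-+ τ W (λ T → r * 𝟙 ⊥ T) (λ T → combT ct T + comb𝟙 c1 T) T')
                      (cong₂ _+_ (push-* τ W r (𝟙 ⊥) T') (push-+ τ W (combT ct) (comb𝟙 c1) T'))))) ⟩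
  push τ W (combination sp r ct c1) T' ∎
  where open ≡-Reasoning

image-⊆ : ∀ {n m} (τ : Fin n → Fin m) {A W} → A ⊆ W → image τ A ⊆ image τ W
image-⊆ τ a = Sub→⊆ (image-mono τ (⊆→Sub a))

repr-push : ∀ {n m} {N : BHyp n} {M' : BHyp m} (τ : Fin n → Fin m) W → InjOn τ W →
  (∀ A C → (A , C) ∈ₗ rel N → A ⊆ W → C ⊆ W → (image τ A , image τ C) ∈ₗ rel M') →
  ∀ {f} → Repr N W f → Repr M' (image τ W) (push τ W f)
repr-push {N = N} {M'} τ W inj rel-image (repr sp r ct c1 a b c e) =
  repr (mapTerms τ sp) r (mapTerms τ ct) (mapIndicators τ c1)
    (AllP.map⁺ (All.map (λ {x} → span {x}) a)) (AllP.map⁺ (All.map (λ {x} → coneT {x}) b))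
    (AllP.map⁺ (All.map (λ {y} → cone𝟙 {y}) c))
    (λ T' → trans (push-cong τ W e T')
                  (sym (combination-push τ W inj sp r ct c1
                         (All.map proj₂ a) (All.map proj₂ b) (All.map proj₂ c) T')))
  where
  span : ∀ {x} → SpanTerm N W x → SpanTerm M' (image τ W) (proj₁ x , image τ (termA x) , image τ (termC x))
  span (m , x , y) = rel-image _ _ m x y , image-⊆ τ x , image-⊆ τ y

  coneT : ∀ {x} → ConeTerm W x → ConeTerm (image τ W) (proj₁ x , image τ (termA x) , image τ (termC x))
  coneT (p , x , y) = p , image-⊆ τ x , image-⊆ τ y

  cone𝟙 : ∀ {y} → ConeIndicator W y → ConeIndicator (image τ W) (proj₁ y , image τ (proj₂ y))
  cone𝟙 (p , x) = p , image-⊆ τ x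

⌊⌋⇒ : ∀ {p} {P : Set p} (d : Dec P) → ⌊ d ⌋ ≡ true → P
⌊⌋⇒ (yes p) _ = p

⇒⌊⌋ : ∀ {p} {P : Set p} (d : Dec P) → P → ⌊ d ⌋ ≡ true
⇒⌊⌋ (yes _) _ = refl
⇒⌊⌋ (no ¬p) p = absurd (¬p p)

frameEdge-elim : ∀ {n} (M : BHyp n) W T → frameEdgeIn M W T ≡ true →
  (∣ T ∣ ≡ 2) × T ⊆ W × T ∈ₗ edges M
frameEdge-elim M W T e =
  let (a , bc) = ∧-e {⌊ ∣ T ∣ ℕ.≟ 2 ⌋} e
      (b , c) = ∧-e {⌊ T ⊆? W ⌋} bc in
  ⌊⌋⇒ (∣ T ∣ ℕ.≟ 2) a , ⌊⌋⇒ (T ⊆? W) b , ⌊⌋⇒ (T ∈E? M) c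

frameEdge-intro : ∀ {n} (M : BHyp n) W T → ∣ T ∣ ≡ 2 → T ⊆ W → T ∈ₗ edges M →
  frameEdgeIn M W T ≡ true
frameEdge-intro M W T a b c =
  ∧-i {⌊ ∣ T ∣ ℕ.≟ 2 ⌋} (⇒⌊⌋ (∣ T ∣ ℕ.≟ 2) a)
      (∧-i {⌊ T ⊆? W ⌋} (⇒⌊⌋ (T ⊆? W) b) (⇒⌊⌋ (T ∈E? M) c))

frameEdge-Sub : ∀ {n} (M : BHyp n) W T → frameEdgeIn M W T ≡ true → Sub T W
frameEdge-Sub M W T e = ⊆→Sub (proj₁ (proj₂ (frameEdge-elim M W T e)))

pair : ∀ {n} → Fin n → Fin n → Subset n
pair u v = ⁅ u ⁆ ∪ ⁅ v ⁆

pair-left : ∀ {n} (u v : Fin n) → memᵇ (pair u v) u ≡ true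
pair-left u v = ∪-l ⁅ u ⁆ ⁅ v ⁆ u (memᵇ-⁅x⁆-self u)

pair-right : ∀ {n} (u v : Fin n) → memᵇ (pair u v) v ≡ true
pair-right u v = ∪-r ⁅ u ⁆ ⁅ v ⁆ v (memᵇ-⁅x⁆-self v)

Sub-pair : ∀ {n} {W : Subset n} {u v} → memᵇ W u ≡ true → memᵇ W v ≡ true → Sub (pair u v) W
Sub-pair {W = W} {u = u} {v} a b = Sub-∪ {A = ⁅ u ⁆} {⁅ v ⁆} {W} (Sub-⁅x⁆ {W = W} {u} a) (Sub-⁅x⁆ {W = W} {v} b)

distinctℚ : ∀ {n} → Fin n → Fin n → ℚ
distinctℚ u v = boolℚ (not ⌊ u F.≟ v ⌋)

vertexTerm : ∀ {n} → Subset n → Subset n → ℚ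
vertexTerm W T = - 𝟙 W T + sumFin (λ v → memℚ W v * 𝟙 ⁅ v ⁆ T)

degreeOf : ∀ {n} → (Subset n → ℚ) → Fin n → ℚ
degreeOf g v = sumFin (λ u → g (pair u v) * distinctℚ u v)

edgeTerm : ∀ {n} → (Subset n → ℚ) → Subset n → ℚ
edgeTerm g T = g T - sumFin (λ v → degreeOf g v * 𝟙 ⁅ v ⁆ T)

frameInd : ∀ {n} → BHyp n → Subset n → Subset n → ℚ
frameInd M W T = boolℚ (frameEdgeIn M W T)

SupportedIn : ∀ {n} → Subset n → (Subset n → ℚ) → Set
SupportedIn W g = ∀ T → g T ≡ 0ℚ ⊎ Sub T W

frameInd-supported : ∀ {n} (M : BHyp n) W → SupportedIn W (frameInd M W)
frameInd-supported M W T with frameEdgeIn M W T in e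
... | true = inj₂ (frameEdge-Sub M W T e)
... | false = inj₁ refl

degreeOf-outside : ∀ {n} W (g : Subset n → ℚ) → SupportedIn W g → ∀ v → memᵇ W v ≡ false → degreeOf g v ≡ 0ℚ
degreeOf-outside W g sp v nv = sum-0 vanish
  where
  vanish : ∀ u → g (pair u v) * distinctℚ u v ≡ 0ℚ
  vanish u with sp (pair u v)
  ... | inj₁ e = trans (cong (_* distinctℚ u v) e) (QP.*-zeroˡ (distinctℚ u v))
  ... | inj₂ s = absurd (f≢t (trans (sym nv) (s v (pair-right u v))))

boolℚ-∧ : ∀ a b → boolℚ (a ∧ b) ≡ boolℚ a * boolℚ b
boolℚ-∧ true b = sym (QP.*-identityˡ (boolℚ b))
boolℚ-∧ false b = sym (QP.*-zeroˡ (boolℚ b))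

deg≡degreeOf : ∀ {n} (M : BHyp n) W v → deg M W v ≡ degreeOf (frameInd M W) v
deg≡degreeOf M W v = sum-cong (λ u → boolℚ-∧ (frameEdgeIn M W (⁅ u ⁆ ∪ ⁅ v ⁆)) _)

⌊∈?⌋≡memᵇ : ∀ {n} (v : Fin n) W → ⌊ v ∈? W ⌋ ≡ memᵇ W v
⌊∈?⌋≡memᵇ v W with v ∈? W
... | yes i = sym (∈⇒memᵇ i)
... | no ni = sym (∉⇒memᵇ ni)

h-split : ∀ {n} (M : BHyp n) W T → h M W T ≡ vertexTerm W T + edgeTerm (frameInd M W) T
h-split {n} M W T =
  trans (cong (λ s → (- 𝟙 W T) + frameInd M W T - s)
              (trans (sum-cong per-vertex) (sum-- (λ v → degreeOf φ v * 𝟙 ⁅ v ⁆ T) (λ v → memℚ W v * 𝟙 ⁅ v ⁆ T))))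
   (solve 4 (λ a b c d → (:- a) :+ b :- (c :- d) := ((:- a) :+ d) :+ (b :- c)) refl
      (𝟙 W T) (frameInd M W T) (sumFin (λ v → degreeOf φ v * 𝟙 ⁅ v ⁆ T)) (sumFin (λ v → memℚ W v * 𝟙 ⁅ v ⁆ T)))
  where
  φ : Subset n → ℚ
  φ = frameInd M W

  per-vertex : ∀ v → boolℚ ⌊ v ∈? W ⌋ * ((deg M W v - 1ℚ) * 𝟙 ⁅ v ⁆ T)
                   ≡ degreeOf φ v * 𝟙 ⁅ v ⁆ T - memℚ W v * 𝟙 ⁅ v ⁆ T
  per-vertex v rewrite ⌊∈?⌋≡memᵇ v W | deg≡degreeOf M W v with memᵇ W v in e
  ... | true = solve 2 (λ d x → con 1ℚ :* ((d :- con 1ℚ) :* x) := d :* x :- con 1ℚ :* x) refl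
                 (degreeOf φ v) (𝟙 ⁅ v ⁆ T)
  ... | false rewrite degreeOf-outside W φ (frameInd-supported M W) v e =
        solve 1 (λ x → con 0ℚ :* ((con 0ℚ :- con 1ℚ) :* x) := con 0ℚ :* x :- con 0ℚ :* x) refl (𝟙 ⁅ v ⁆ T)

degreeOf-cong : ∀ {n} {g g' : Subset n → ℚ} → (∀ T → g T ≡ g' T) → ∀ v → degreeOf g v ≡ degreeOf g' v
degreeOf-cong e v = sum-cong (λ u → cong (_* distinctℚ u v) (e (pair u v)))

edgeTerm-cong : ∀ {n} {g g' : Subset n → ℚ} → (∀ T → g T ≡ g' T) → ∀ T → edgeTerm g T ≡ edgeTerm g' T
edgeTerm-cong e T = cong₂ _-_ (e T) (sum-cong (λ v → cong (_* 𝟙 ⁅ v ⁆ T) (degreeOf-cong e v)))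

degreeOf-+ : ∀ {n} (a b : Subset n → ℚ) v → degreeOf (λ T → a T + b T) v ≡ degreeOf a v + degreeOf b v
degreeOf-+ a b v = trans (sum-cong (λ u → QP.*-distribʳ-+ (distinctℚ u v) (a (pair u v)) (b (pair u v))))
                         (sum-+ (λ u → a (pair u v) * distinctℚ u v) (λ u → b (pair u v) * distinctℚ u v))

degreeOf-neg : ∀ {n} (a : Subset n → ℚ) v → degreeOf (λ T → - a T) v ≡ - degreeOf a v
degreeOf-neg a v = trans (sum-cong (λ u → sym (QP.neg-distribˡ-* (a (pair u v)) (distinctℚ u v))))
                         (sum-neg (λ u → a (pair u v) * distinctℚ u v))

edgeTerm-+ : ∀ {n} (a b : Subset n → ℚ) T → edgeTerm (λ T → a T + b T) T ≡ edgeTerm a T + edgeTerm b T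
edgeTerm-+ a b T =
  trans (cong (λ s → a T + b T - s)
          (trans (sum-cong (λ v → trans (cong (_* 𝟙 ⁅ v ⁆ T) (degreeOf-+ a b v))
                                        (QP.*-distribʳ-+ (𝟙 ⁅ v ⁆ T) (degreeOf a v) (degreeOf b v))))
                 (sum-+ (λ v → degreeOf a v * 𝟙 ⁅ v ⁆ T) (λ v → degreeOf b v * 𝟙 ⁅ v ⁆ T))))
        (solve 4 (λ x y p q → x :+ y :- (p :+ q) := (x :- p) :+ (y :- q)) refl
           (a T) (b T) (sumFin (λ v → degreeOf a v * 𝟙 ⁅ v ⁆ T)) (sumFin (λ v → degreeOf b v * 𝟙 ⁅ v ⁆ T)))

edgeTerm-neg : ∀ {n} (a : Subset n → ℚ) T → edgeTerm (λ T → - a T) T ≡ - edgeTerm a T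
edgeTerm-neg a T =
  trans (cong (λ s → - a T - s)
          (trans (sum-cong (λ v → trans (cong (_* 𝟙 ⁅ v ⁆ T) (degreeOf-neg a v))
                                        (sym (QP.neg-distribˡ-* (degreeOf a v) (𝟙 ⁅ v ⁆ T)))))
                 (sum-neg (λ v → degreeOf a v * 𝟙 ⁅ v ⁆ T))))
        (solve 2 (λ x p → :- x :- (:- p) := :- (x :- p)) refl (a T) (sumFin (λ v → degreeOf a v * 𝟙 ⁅ v ⁆ T)))

edgeTerm-lin : ∀ {n} (a b c : Subset n → ℚ) T →
  edgeTerm (λ T → a T + b T - c T) T ≡ edgeTerm a T + edgeTerm b T - edgeTerm c T
edgeTerm-lin a b c T =
  trans (edgeTerm-+ (λ T → a T + b T) (λ T → - c T) T) (cong₂ _+_ (edgeTerm-+ a b T) (edgeTerm-neg c T))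

reindex-supported : ∀ {n m} (τ : Fin n → Fin m) (W : Subset n) → InjOn τ W → (f : Fin m → ℚ) →
  (∀ w → memᵇ (image τ W) w ≡ false → f w ≡ 0ℚ) →
  sumFin f ≡ sumFin (λ v → memℚ W v * f (τ v))
reindex-supported τ W inj f out =
  trans (sym (sum-cong (λ w → memℚ-mul-drop (image τ W) w (out w)))) (reindex τ W inj f)

push-singletons : ∀ {n m} (τ : Fin n → Fin m) W → InjOn τ W → (c : Fin m → ℚ) (d : Fin n → ℚ) →
  (∀ w → memᵇ (image τ W) w ≡ false → c w ≡ 0ℚ) →
  (∀ v → memᵇ W v ≡ true → c (τ v) ≡ d v) → (∀ v → memᵇ W v ≡ false → d v ≡ 0ℚ) → ∀ T' →
  sumFin (λ w → c w * 𝟙 ⁅ w ⁆ T') ≡ push τ W (λ T → sumFin (λ v → d v * 𝟙 ⁅ v ⁆ T)) T'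
push-singletons τ W inj c d c-out c-d d-out T' = begin
  sumFin (λ w → c w * 𝟙 ⁅ w ⁆ T')
    ≡⟨ reindex-supported τ W inj (λ w → c w * 𝟙 ⁅ w ⁆ T')
         (λ w o → trans (cong (_* 𝟙 ⁅ w ⁆ T') (c-out w o)) (QP.*-zeroˡ (𝟙 ⁅ w ⁆ T'))) ⟩
  sumFin (λ v → memℚ W v * (c (τ v) * 𝟙 ⁅ τ v ⁆ T'))
    ≡⟨ sum-cong (λ v → memℚ-mul-cong W v (λ wv →
         cong₂ _*_ (c-d v wv) (trans (cong (λ X → 𝟙 X T') (sym (image-⁅x⁆ τ v)))
                                     (push-𝟙 τ W inj ⁅ v ⁆ (Sub-⁅x⁆ {W = W} {v} wv) T')))) ⟩
  sumFin (λ v → memℚ W v * (d v * push τ W (𝟙 ⁅ v ⁆) T'))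
    ≡⟨ sum-cong (λ v → memℚ-mul-drop W v (λ nv → trans (cong (_* push τ W (𝟙 ⁅ v ⁆) T') (d-out v nv))
                                                         (QP.*-zeroˡ (push τ W (𝟙 ⁅ v ⁆) T')))) ⟩
  sumFin (λ v → d v * push τ W (𝟙 ⁅ v ⁆) T')
    ≡⟨ sym (trans (push-sum τ W (λ v T → d v * 𝟙 ⁅ v ⁆ T) T')
                  (sum-cong (λ v → push-* τ W (d v) (𝟙 ⁅ v ⁆) T'))) ⟩
  push τ W (λ T → sumFin (λ v → d v * 𝟙 ⁅ v ⁆ T)) T' ∎
  where open ≡-Reasoning

vertexTerm-push : ∀ {n m} (τ : Fin n → Fin m) W → InjOn τ W → ∀ T' →
  vertexTerm (image τ W) T' ≡ push τ W (vertexTerm W) T'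
vertexTerm-push τ W inj T' =
  trans (cong₂ _+_ (cong -_ (push-𝟙 τ W inj W (Sub-refl {A = W}) T'))
                   (push-singletons τ W inj (memℚ (image τ W)) (memℚ W)
                      (λ w o → cong boolℚ o) (λ v wv → cong boolℚ (trans (image-intro τ W v wv) (sym wv)))
                      (λ v o → cong boolℚ o) T'))
  (sym (trans (push-+ τ W (λ T → - 𝟙 W T) (λ T → sumFin (λ v → memℚ W v * 𝟙 ⁅ v ⁆ T)) T')
              (cong (_+ push τ W (λ T → sumFin (λ v → memℚ W v * 𝟙 ⁅ v ⁆ T)) T') (push-neg τ W (𝟙 W) T'))))

image-pair : ∀ {n m} (τ : Fin n → Fin m) u v → image τ (pair u v) ≡ pair (τ u) (τ v)
image-pair τ u v = trans (image-∪ τ ⁅ u ⁆ ⁅ v ⁆) (cong₂ _∪_ (image-⁅x⁆ τ u) (image-⁅x⁆ τ v))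

distinctℚ-injOn : ∀ {n m} (τ : Fin n → Fin m) W → InjOn τ W → ∀ u v → memᵇ W u ≡ true → memᵇ W v ≡ true →
  distinctℚ (τ u) (τ v) ≡ distinctℚ u v
distinctℚ-injOn τ W inj u v a b with u F.≟ v
... | yes refl with τ u F.≟ τ u
... | yes _ = refl
... | no ne = absurd (ne refl)
distinctℚ-injOn τ W inj u v a b | no ne with τ u F.≟ τ v
... | yes e = absurd (ne (inj u v a b e))
... | no _ = refl

degreeOf-push-outside : ∀ {n m} (τ : Fin n → Fin m) W → InjOn τ W → ∀ g v' →
  memᵇ (image τ W) v' ≡ false → degreeOf (push τ W g) v' ≡ 0ℚ
degreeOf-push-outside τ W inj g v' o = sum-0 (λ u' →
  trans (cong (_* distinctℚ u' v') (push-zero-outside τ W inj g (pair u' v') v' (pair-right u' v') o))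
        (QP.*-zeroˡ (distinctℚ u' v')))

degreeOf-push-inside : ∀ {n m} (τ : Fin n → Fin m) W → InjOn τ W → ∀ g → SupportedIn W g → ∀ v →
  memᵇ W v ≡ true → degreeOf (push τ W g) (τ v) ≡ degreeOf g v
degreeOf-push-inside τ W inj g sp v wv = begin
  degreeOf (push τ W g) (τ v)
    ≡⟨ reindex-supported τ W inj (λ u' → push τ W g (pair u' (τ v)) * distinctℚ u' (τ v))
         (λ u' o → trans (cong (_* distinctℚ u' (τ v))
                                (push-zero-outside τ W inj g (pair u' (τ v)) u' (pair-left u' (τ v)) o))
                         (QP.*-zeroˡ (distinctℚ u' (τ v)))) ⟩
  sumFin (λ u → memℚ W u * (push τ W g (pair (τ u) (τ v)) * distinctℚ (τ u) (τ v)))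
    ≡⟨ sum-cong (λ u → memℚ-mul-cong W u (λ wu →
         cong₂ _*_ (trans (cong (push τ W g) (sym (image-pair τ u v)))
                          (push-at-image τ W inj (pair u v) (Sub-pair {W = W} {u} {v} wu wv) g))
                   (distinctℚ-injOn τ W inj u v wu wv))) ⟩
  sumFin (λ u → memℚ W u * (g (pair u v) * distinctℚ u v))
    ≡⟨ sum-cong (λ u → memℚ-mul-drop W u (vanish u)) ⟩
  degreeOf g v ∎
  where
  open ≡-Reasoning

  vanish : ∀ u → memᵇ W u ≡ false → g (pair u v) * distinctℚ u v ≡ 0ℚ
  vanish u nu with sp (pair u v)
  ... | inj₁ e = trans (cong (_* distinctℚ u v) e) (QP.*-zeroˡ (distinctℚ u v))
  ... | inj₂ s = absurd (f≢t (trans (sym nu) (s u (pair-left u v))))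

edgeTerm-push : ∀ {n m} (τ : Fin n → Fin m) W → InjOn τ W → ∀ g → SupportedIn W g → ∀ T' →
  edgeTerm (push τ W g) T' ≡ push τ W (edgeTerm g) T'
edgeTerm-push τ W inj g sp T' =
  trans (cong (λ s → push τ W g T' - s)
          (push-singletons τ W inj (degreeOf (push τ W g)) (degreeOf g) (degreeOf-push-outside τ W inj g)
             (degreeOf-push-inside τ W inj g sp) (degreeOf-outside W g sp) T'))
        (sym (push-- τ W g (λ T → sumFin (λ v → degreeOf g v * 𝟙 ⁅ v ⁆ T)) T'))

-- h of an image: both terms of the splitting commute with push.
h-image : ∀ {n m} (N : BHyp n) (M' : BHyp m) (τ : Fin n → Fin m) W → InjOn τ W →
  (∀ T' → frameInd M' (image τ W) T' ≡ push τ W (frameInd N W) T') →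
  ∀ T' → h M' (image τ W) T' ≡ push τ W (h N W) T'
h-image N M' τ W inj φ-push T' =
  trans (h-split M' (image τ W) T')
  (trans (cong₂ _+_ (vertexTerm-push τ W inj T')
            (trans (edgeTerm-cong φ-push T') (edgeTerm-push τ W inj (frameInd N W) (frameInd-supported N W) T')))
  (trans (sym (push-+ τ W (vertexTerm W) (edgeTerm (frameInd N W)) T'))
         (sym (push-cong τ W (h-split N W) T'))))

memℚ-∪ : ∀ {n} (P Q : Subset n) v → memℚ (P ∪ Q) v ≡ memℚ P v + memℚ Q v - memℚ (P ∩ Q) v
memℚ-∪ P Q v rewrite memᵇ-∪ P Q v | memᵇ-∩ P Q v with memᵇ P v | memᵇ Q v
... | true | true = refl
... | true | false = refl
... | false | true = refl
... | false | false = refl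

vertexTerm-∪ : ∀ {n} (P Q R : Subset n) → P ∩ Q ≡ R → ∀ T →
  vertexTerm (P ∪ Q) T ≡ vertexTerm P T + vertexTerm Q T - vertexTerm R T - t P Q T
vertexTerm-∪ P Q R refl T =
  trans (cong (- 𝟙 (P ∪ Q) T +_)
    (trans (sum-cong (λ v → trans (cong (_* 𝟙 ⁅ v ⁆ T) (memℚ-∪ P Q v))
               (solve 4 (λ x y z w → (x :+ y :- z) :* w := x :* w :+ y :* w :- z :* w) refl
                  (memℚ P v) (memℚ Q v) (memℚ (P ∩ Q) v) (𝟙 ⁅ v ⁆ T))))
     (trans (sum-- (λ v → memℚ P v * 𝟙 ⁅ v ⁆ T + memℚ Q v * 𝟙 ⁅ v ⁆ T) (λ v → memℚ (P ∩ Q) v * 𝟙 ⁅ v ⁆ T))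
            (cong (_- sumFin (λ v → memℚ (P ∩ Q) v * 𝟙 ⁅ v ⁆ T))
                  (sum-+ (λ v → memℚ P v * 𝟙 ⁅ v ⁆ T) (λ v → memℚ Q v * 𝟙 ⁅ v ⁆ T))))))
  (solve 7 (λ u p q r sp sq sr → (:- u) :+ (sp :+ sq :- sr)
              := ((:- p) :+ sp) :+ ((:- q) :+ sq) :- ((:- r) :+ sr) :- (u :- p :- q :+ r)) refl
     (𝟙 (P ∪ Q) T) (𝟙 P T) (𝟙 Q T) (𝟙 (P ∩ Q) T)
     (sumFin (λ v → memℚ P v * 𝟙 ⁅ v ⁆ T)) (sumFin (λ v → memℚ Q v * 𝟙 ⁅ v ⁆ T))
     (sumFin (λ v → memℚ (P ∩ Q) v * 𝟙 ⁅ v ⁆ T)))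

h-∪ : ∀ {n} (M : BHyp n) (P Q R : Subset n) → P ∩ Q ≡ R →
  (∀ T → frameInd M (P ∪ Q) T ≡ frameInd M P T + frameInd M Q T - frameInd M R T) →
  ∀ T → h M (P ∪ Q) T ≡ h M P T + h M Q T - h M R T - t P Q T
h-∪ M P Q R cap φ-∪ T = begin
  h M (P ∪ Q) T
    ≡⟨ h-split M (P ∪ Q) T ⟩
  vertexTerm (P ∪ Q) T + edgeTerm (frameInd M (P ∪ Q)) T
    ≡⟨ cong₂ _+_ (vertexTerm-∪ P Q R cap T)
                 (trans (edgeTerm-cong φ-∪ T) (edgeTerm-lin (frameInd M P) (frameInd M Q) (frameInd M R) T)) ⟩
  (vP + vQ - vR - t P Q T) + (eP + eQ - eR)
    ≡⟨ solve 7 (λ vP vQ vR eP eQ eR tPQ → (vP :+ vQ :- vR :- tPQ) :+ (eP :+ eQ :- eR)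
                  := (vP :+ eP) :+ (vQ :+ eQ) :- (vR :+ eR) :- tPQ) refl
         vP vQ vR eP eQ eR (t P Q T) ⟩
  (vP + eP) + (vQ + eQ) - (vR + eR) - t P Q T
    ≡⟨ sym (cong₂ _-_ (cong₂ _-_ (cong₂ _+_ (h-split M P T) (h-split M Q T)) (h-split M R T)) refl) ⟩
  h M P T + h M Q T - h M R T - t P Q T ∎
  where
  open ≡-Reasoning
  vP = vertexTerm P T
  vQ = vertexTerm Q T
  vR = vertexTerm R T
  eP = edgeTerm (frameInd M P) T
  eQ = edgeTerm (frameInd M Q) T
  eR = edgeTerm (frameInd M R) T

remove-self : ∀ {n} (p : Subset n) x → memᵇ (p ∖ₛ x) x ≡ false
remove-self (s V.∷ p) zero = refl
remove-self (s V.∷ p) (suc x) = remove-self p x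

remove-Sub : ∀ {n} (p : Subset n) x y → memᵇ (p ∖ₛ x) y ≡ true → memᵇ p y ≡ true
remove-Sub p x y e = ∈⇒memᵇ (SP.p─q⊆p p ⁅ x ⁆ (memᵇ⇒∈ e))

remove-keeps : ∀ {n} (p : Subset n) x y → memᵇ p y ≡ true → y ≢ x → memᵇ (p ∖ₛ x) y ≡ true
remove-keeps p x y e ne = ∈⇒memᵇ {S = p ∖ₛ x} (SP.x∈p∧x≢y⇒x∈p-y {p = p} (memᵇ⇒∈ {S = p} e) ne)

remove-other : ∀ {n} (p : Subset n) x y → memᵇ (p ∖ₛ x) y ≡ true → y ≢ x
remove-other p x y e refl = f≢t (trans (sym (remove-self p x)) e)

card-remove : ∀ {n} (p : Subset n) x → memᵇ p x ≡ true → suc ∣ p ∖ₛ x ∣ ≡ ∣ p ∣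
card-remove (true V.∷ p) zero e = cong suc (cong ∣_∣ (SP.p─⊥≡p p))
card-remove (true V.∷ p) (suc x) e = cong suc (card-remove p x e)
card-remove (false V.∷ p) (suc x) e = card-remove p x e

card0⇒empty : ∀ {n} (p : Subset n) → ∣ p ∣ ≡ 0 → ∀ x → memᵇ p x ≡ false
card0⇒empty p c x = BP.¬-not (λ e → NP.1+n≢0 (trans (card-remove p x e) c))

nonempty : ∀ {n} (p : Subset n) {k} → ∣ p ∣ ≡ suc k → ∃ λ x → memᵇ p x ≡ true
nonempty {n} p c with SP.nonempty? p
... | yes (x , i) = x , ∈⇒memᵇ i
... | no ne = absurd (NP.1+n≢0 (trans (sym c) (trans (cong ∣_∣ (SP.Empty-unique ne)) (SP.∣⊥∣≡0 n))))

IsPair : ∀ {n} → Subset n → Set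
IsPair {n} T = Σ (Fin n) λ a → Σ (Fin n) λ b → a ≢ b × T ≡ pair a b

pair-elim : ∀ {n} (a b x : Fin n) → memᵇ (pair a b) x ≡ true → x ≡ a ⊎ x ≡ b
pair-elim a b x e with ∪-e ⁅ a ⁆ ⁅ b ⁆ x e
... | inj₁ i = inj₁ (memᵇ-⁅x⁆⇒≡ {y = a} {x = x} i)
... | inj₂ i = inj₂ (memᵇ-⁅x⁆⇒≡ {y = b} {x = x} i)

card2⇒pair : ∀ {n} (T : Subset n) → ∣ T ∣ ≡ 2 → IsPair T
card2⇒pair T c with nonempty T c
... | a , ia with nonempty (T ∖ₛ a) {0} (NP.suc-injective (trans (card-remove T a ia) c))
... | b , ib = a , b , (λ e → remove-other T a b ib (sym e)) , setext f g
  where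
  c0 : ∣ T ∖ₛ a ∖ₛ b ∣ ≡ 0
  c0 = NP.suc-injective (trans (card-remove (T ∖ₛ a) b ib) (NP.suc-injective (trans (card-remove T a ia) c)))

  f : Sub T (pair a b)
  f x e with x F.≟ a | x F.≟ b
  ... | yes refl | _ = pair-left x b
  ... | no _ | yes refl = pair-right a x
  ... | no na | no nb = absurd (f≢t (trans (sym (card0⇒empty (T ∖ₛ a ∖ₛ b) c0 x))
                           (remove-keeps (T ∖ₛ a) b x (remove-keeps T a x e na) nb)))

  g : Sub (pair a b) T
  g x e with pair-elim a b x e
  ... | inj₁ refl = ia
  ... | inj₂ refl = remove-Sub T a x ib

pair-card : ∀ {n} (a b : Fin n) → a ≢ b → ∣ pair a b ∣ ≡ 2
pair-card a b ne = trans (sym (card-remove (pair a b) b (pair-right a b)))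
                         (cong suc (trans (cong ∣_∣ eq) (SP.∣⁅x⁆∣≡1 a)))
  where
  eq : pair a b ∖ₛ b ≡ ⁅ a ⁆
  eq = setext (λ x e → case x e) (λ x e → sub x e)
    where
    case : ∀ x → memᵇ (pair a b ∖ₛ b) x ≡ true → memᵇ ⁅ a ⁆ x ≡ true
    case x e with pair-elim a b x (remove-Sub (pair a b) b x e)
    ... | inj₁ refl = memᵇ-⁅x⁆-self x
    ... | inj₂ refl = absurd (remove-other (pair a b) b x e refl)
    sub : ∀ x → memᵇ ⁅ a ⁆ x ≡ true → memᵇ (pair a b ∖ₛ b) x ≡ true
    sub x e with memᵇ-⁅x⁆⇒≡ {y = a} {x = x} e
    ... | refl = remove-keeps (pair a b) b x (pair-left x b) ne

IsPair-image : ∀ {n m} (τ : Fin n → Fin m) S → InjOn τ S → IsPair S → IsPair (image τ S)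
IsPair-image τ S inj (a , b , ne , refl) =
  τ a , τ b , (λ e → ne (inj a b (pair-left a b) (pair-right a b) e)) , image-pair τ a b

IsPair-preimage : ∀ {n m} (τ : Fin n → Fin m) S → InjOn τ S → IsPair (image τ S) → IsPair S
IsPair-preimage τ S inj (a' , b' , ne , eq) with image-elim τ S a' (subst (λ X → memᵇ X a' ≡ true) (sym eq) (pair-left a' b'))
                                        | image-elim τ S b' (subst (λ X → memᵇ X b' ≡ true) (sym eq) (pair-right a' b'))
... | a , ia , refl | b , ib , refl = a , b , (λ e → ne (cong τ e)) , setext f g
  where
  f : Sub S (pair a b)
  f x e with pair-elim (τ a) (τ b) (τ x) (subst (λ X → memᵇ X (τ x) ≡ true) eq (image-intro τ S x e))
  ... | inj₁ q with inj x a e ia q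
  ... | refl = pair-left x b
  f x e | inj₂ q with inj x b e ib q
  ... | refl = pair-right a x

  g : Sub (pair a b) S
  g x e with pair-elim a b x e
  ... | inj₁ refl = ia
  ... | inj₂ refl = ib

card2-preimage : ∀ {n m} (τ : Fin n → Fin m) S → InjOn τ S → ∣ image τ S ∣ ≡ 2 → ∣ S ∣ ≡ 2
card2-preimage τ S inj c with IsPair-preimage τ S inj (card2⇒pair (image τ S) c)
... | a , b , ne , refl = pair-card a b ne

card2-image : ∀ {n m} (τ : Fin n → Fin m) S → InjOn τ S → ∣ S ∣ ≡ 2 → ∣ image τ S ∣ ≡ 2
card2-image τ S inj c with IsPair-image τ S inj (card2⇒pair S c)
... | a , b , ne , e = trans (cong ∣_∣ e) (pair-card a b ne)

no-three-in-pair : ∀ {n} (T : Subset n) x y z → memᵇ T x ≡ true → memᵇ T y ≡ true → memᵇ T z ≡ true →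
  x ≢ y → x ≢ z → y ≢ z → ¬ (∣ T ∣ ≡ 2)
no-three-in-pair T x y z ix iy iz nxy nxz nyz c with card2⇒pair T c
... | a , b , ne , refl with pair-elim a b x ix | pair-elim a b y iy | pair-elim a b z iz
... | inj₁ refl | inj₁ refl | _ = nxy refl
... | inj₂ refl | inj₂ refl | _ = nxy refl
... | inj₁ refl | inj₂ refl | inj₁ refl = nxz refl
... | inj₁ refl | inj₂ refl | inj₂ refl = nyz refl
... | inj₂ refl | inj₁ refl | inj₁ refl = nyz refl
... | inj₂ refl | inj₁ refl | inj₂ refl = nxz refl

pair-comm : ∀ {n} (a b : Fin n) → pair a b ≡ pair b a
pair-comm a b = SP.∪-comm ⁅ a ⁆ ⁅ b ⁆

pair-outside : ∀ {n} (a b z : Fin n) → z ≢ a → z ≢ b → memᵇ (pair a b) z ≡ false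
pair-outside a b z na nb = BP.¬-not (λ e → either na nb (pair-elim a b z e))

ImageOf : ∀ {n m} (τ : Fin n → Fin m) (F : Subset n → Bool) (T' : Subset m) → Set
ImageOf {n} τ F T' = Σ (Subset n) λ S → F S ≡ true × T' ≡ image τ S

push-bool : ∀ {n m} (τ : Fin n → Fin m) W → InjOn τ W → (F : Subset n → Bool) →
  (∀ S → F S ≡ true → Sub S W) → ∀ T' →
  Σ Bool λ β → push τ W (λ T → boolℚ (F T)) T' ≡ boolℚ β
             × (β ≡ true → ImageOf τ F T') × (ImageOf τ F T' → β ≡ true)
push-bool τ W inj F fs T' with push-cases τ W inj T'
... | inj₁ (S0 , s0 , refl , h) = F S0 , h (λ T → boolℚ (F T)) , (λ e → S0 , e , refl) ,
      (λ { (S , e , q) → subst (λ Z → F Z ≡ true) (image-inj τ W inj S S0 (fs S e) s0 (sym q)) e })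
... | inj₂ (h , z) = false , z (λ T → boolℚ (F T)) , (λ ()) ,
      (λ { (S , e , q) → absurd (h S (fs S e) q) })

bool-ext-via : ∀ {b : Bool} {P : Set} (β : Bool) → (b ≡ true → P) → (P → b ≡ true) →
  (β ≡ true → P) → (P → β ≡ true) → b ≡ β
bool-ext-via β f g f' g' = bool-ext (λ e → g' (f e)) (λ e → g (f' e))

boolℚ-incl-excl : ∀ (b b₁ b₂ b∩ : Bool) → (b ≡ true → b₁ ≡ true ⊎ b₂ ≡ true) → (b₁ ≡ true → b ≡ true) →
  (b₂ ≡ true → b ≡ true) → (b∩ ≡ true → b₁ ≡ true × b₂ ≡ true) → (b₁ ≡ true → b₂ ≡ true → b∩ ≡ true) →
  boolℚ b ≡ boolℚ b₁ + boolℚ b₂ - boolℚ b∩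
boolℚ-incl-excl b true true true _ from₁ _ _ _ rewrite from₁ refl = refl
boolℚ-incl-excl b true true false _ _ _ _ both = absurd (f≢t (both refl refl))
boolℚ-incl-excl b true false true _ _ _ split _ = absurd (f≢t (proj₂ (split refl)))
boolℚ-incl-excl b true false false _ from₁ _ _ _ rewrite from₁ refl = refl
boolℚ-incl-excl b false true true _ _ _ split _ = absurd (f≢t (proj₁ (split refl)))
boolℚ-incl-excl b false true false _ _ from₂ _ _ rewrite from₂ refl = refl
boolℚ-incl-excl b false false true _ _ _ split _ = absurd (f≢t (proj₁ (split refl)))
boolℚ-incl-excl true false false false to _ _ _ _ with to refl
... | inj₁ ()
... | inj₂ ()
boolℚ-incl-excl false false false false _ _ _ _ _ = refl

frameEdge-widen : ∀ {n} (M : BHyp n) {W W'} → Sub W W' → ∀ T → frameEdgeIn M W T ≡ true → frameEdgeIn M W' T ≡ true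
frameEdge-widen M {W} {W'} ww T f with frameEdge-elim M W T f
... | c , s , e = frameEdge-intro M W' T c (Sub→⊆ (Sub-trans {A = T} {W} {W'} (⊆→Sub s) ww)) e

frameInd-∪ : ∀ {n} (M : BHyp n) (P Q : Subset n) →
  (∀ T → T ∈ₗ edges M → ∣ T ∣ ≡ 2 → Sub T (P ∪ Q) → Sub T P ⊎ Sub T Q) →
  ∀ T → frameInd M (P ∪ Q) T ≡ frameInd M P T + frameInd M Q T - frameInd M (P ∩ Q) T
frameInd-∪ M P Q split T =
  boolℚ-incl-excl (frameEdgeIn M (P ∪ Q) T) (frameEdgeIn M P T) (frameEdgeIn M Q T) (frameEdgeIn M (P ∩ Q) T)
    to (frameEdge-widen M (∪-l P Q) T) (frameEdge-widen M (∪-r P Q) T)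
    (λ f → frameEdge-widen M (Sub-∩ {A = P} {Q} {P} (Sub-refl {A = P})) T f ,
           frameEdge-widen M (λ x e → proj₂ (∩-e P Q x e)) T f)
    both
  where
  to : frameEdgeIn M (P ∪ Q) T ≡ true → frameEdgeIn M P T ≡ true ⊎ frameEdgeIn M Q T ≡ true
  to f with frameEdge-elim M (P ∪ Q) T f
  ... | c , s , e with split T e c (⊆→Sub s)
  ... | inj₁ sP = inj₁ (frameEdge-intro M P T c (Sub→⊆ sP) e)
  ... | inj₂ sQ = inj₂ (frameEdge-intro M Q T c (Sub→⊆ sQ) e)

  both : frameEdgeIn M P T ≡ true → frameEdgeIn M Q T ≡ true → frameEdgeIn M (P ∩ Q) T ≡ true
  both f g with frameEdge-elim M P T f | frameEdge-elim M Q T g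
  ... | c , sP , e | _ , sQ , _ =
    frameEdge-intro M (P ∩ Q) T c (Sub→⊆ (λ x i → ∩-i P Q x (⊆→Sub sP x i) (⊆→Sub sQ x i))) e

NoSingleton : ∀ {n} → BHyp n → Set
NoSingleton N = ∀ K → K ∈ₗ edges N → ∀ a → memᵇ K a ≡ true → ∃ λ c → memᵇ K c ≡ true × c ≢ a

𝟙-sep : ∀ {n} (S T : Subset n) y → memᵇ T y ≡ true → memᵇ S y ≡ false → 𝟙 S T ≡ 0ℚ
𝟙-sep S T y i o = 𝟙-diff (λ e → f≢t (trans (sym o) (trans (cong (λ Z → memᵇ Z y) (sym e)) i)))

distinctℚ-other : ∀ {n} {u v : Fin n} → u ≢ v → distinctℚ u v ≡ 1ℚ
distinctℚ-other {u = u} {v} ne with u F.≟ v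
... | yes e = absurd (ne e)
... | no _ = refl

degreeOf-pair-end : ∀ {n} (u v : Fin n) → u ≢ v → degreeOf (𝟙 (pair u v)) v ≡ 1ℚ
degreeOf-pair-end u v uv =
  trans (sum-δ u vanish) (trans (cong₂ _*_ (𝟙-same (pair u v)) (distinctℚ-other uv)) (QP.*-identityˡ 1ℚ))
  where
  vanish : ∀ y → y ≢ u → 𝟙 (pair u v) (pair y v) * distinctℚ y v ≡ 0ℚ
  vanish y yu with y F.≟ v
  ... | yes refl = QP.*-zeroʳ (𝟙 (pair u y) (pair y y))
  ... | no yv = trans (cong (_* 1ℚ) (𝟙-sep (pair u v) (pair y v) y (pair-left y v) (pair-outside u v y yu yv)))
                      (QP.*-zeroˡ 1ℚ)

degreeOf-pair-outside : ∀ {n} (u v w : Fin n) → w ≢ u → w ≢ v → degreeOf (𝟙 (pair u v)) w ≡ 0ℚ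
degreeOf-pair-outside u v w wu wv = sum-0 (λ y →
  trans (cong (_* distinctℚ y w) (𝟙-sep (pair u v) (pair y w) w (pair-right y w) (pair-outside u v w wu wv)))
        (QP.*-zeroˡ (distinctℚ y w)))

degreeOf-pair : ∀ {n} (u v : Fin n) → u ≢ v → ∀ w → degreeOf (𝟙 (pair u v)) w ≡ δ w u + δ w v
degreeOf-pair u v uv w with w F.≟ u | w F.≟ v
... | yes refl | yes refl = absurd (uv refl)
... | yes refl | no wv = trans (cong (λ Z → degreeOf (𝟙 Z) w) (pair-comm w v))
                               (trans (degreeOf-pair-end v w (λ e → uv (sym e))) (sym (QP.+-identityʳ 1ℚ)))
... | no wu | yes refl = trans (degreeOf-pair-end u w uv) (sym (QP.+-identityˡ 1ℚ))
... | no wu | no wv = degreeOf-pair-outside u v w wu wv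

edgeTerm-pair : ∀ {n} (u v : Fin n) → u ≢ v → ∀ T →
  edgeTerm (𝟙 (pair u v)) T ≡ 𝟙 (pair u v) T - (𝟙 ⁅ u ⁆ T + 𝟙 ⁅ v ⁆ T)
edgeTerm-pair u v uv T = cong (λ s → 𝟙 (pair u v) T - s)
  (trans (sum-cong (λ w → trans (cong (_* 𝟙 ⁅ w ⁆ T) (degreeOf-pair u v uv w))
                                (QP.*-distribʳ-+ (𝟙 ⁅ w ⁆ T) (δ w u) (δ w v))))
  (trans (sum-+ (λ w → δ w u * 𝟙 ⁅ w ⁆ T) (λ w → δ w v * 𝟙 ⁅ w ⁆ T))
         (cong₂ _+_ (sum-δʳ u (λ w → 𝟙 ⁅ w ⁆ T)) (sum-δʳ v (λ w → 𝟙 ⁅ w ⁆ T)))))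

memℚ-remove : ∀ {n} (X : Subset n) v → memᵇ X v ≡ true → ∀ w → memℚ X w ≡ memℚ (X ∖ₛ v) w + δ w v
memℚ-remove X v xv w with w F.≟ v
... | yes refl rewrite xv | remove-self X w = refl
... | no wv = trans (cong boolℚ (bool-ext (λ e → remove-keeps X v w e wv) (remove-Sub X v w))) (sym (QP.+-identityʳ _))

vertexTerm-remove : ∀ {n} (X : Subset n) v → memᵇ X v ≡ true → ∀ T →
  vertexTerm X T ≡ vertexTerm (X ∖ₛ v) T - 𝟙 X T + 𝟙 (X ∖ₛ v) T + 𝟙 ⁅ v ⁆ T
vertexTerm-remove X v xv T =
  trans (cong (- 𝟙 X T +_)
    (trans (sum-cong (λ w → trans (cong (_* 𝟙 ⁅ w ⁆ T) (memℚ-remove X v xv w))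
                          (QP.*-distribʳ-+ (𝟙 ⁅ w ⁆ T) (memℚ (X ∖ₛ v) w) (δ w v))))
    (trans (sum-+ (λ w → memℚ (X ∖ₛ v) w * 𝟙 ⁅ w ⁆ T) (λ w → δ w v * 𝟙 ⁅ w ⁆ T))
           (cong (sumFin (λ w → memℚ (X ∖ₛ v) w * 𝟙 ⁅ w ⁆ T) +_) (sum-δʳ v (λ w → 𝟙 ⁅ w ⁆ T))))))
  (solve 4 (λ x y s p → (:- x) :+ (s :+ p) := (:- y) :+ s :- x :+ y :+ p) refl
     (𝟙 X T) (𝟙 (X ∖ₛ v) T) (sumFin (λ w → memℚ (X ∖ₛ v) w * 𝟙 ⁅ w ⁆ T)) (𝟙 ⁅ v ⁆ T))

remove-∪-pair : ∀ {n} (X : Subset n) u v → memᵇ X u ≡ true → memᵇ X v ≡ true → (X ∖ₛ v) ∪ pair u v ≡ X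
remove-∪-pair X u v xu xv = setext (Sub-∪ {A = X ∖ₛ v} {pair u v} {X} (remove-Sub X v) (Sub-pair {W = X} {u} {v} xu xv)) g
  where g : Sub X ((X ∖ₛ v) ∪ pair u v)
        g y i with y F.≟ v
        ... | yes refl = ∪-r (X ∖ₛ y) (pair u y) y (pair-right u y)
        ... | no yv = ∪-l (X ∖ₛ v) (pair u v) y (remove-keeps X v y i yv)

remove-∩-pair : ∀ {n} (X : Subset n) u v → memᵇ X u ≡ true → u ≢ v → (X ∖ₛ v) ∩ pair u v ≡ ⁅ u ⁆
remove-∩-pair X u v xu uv = setext f g
  where f : Sub ((X ∖ₛ v) ∩ pair u v) ⁅ u ⁆
        f y i with ∩-e (X ∖ₛ v) (pair u v) y i
        ... | a , b with pair-elim u v y b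
        ... | inj₁ refl = memᵇ-⁅x⁆-self y
        ... | inj₂ refl = absurd (remove-other X y y a refl)
        g : Sub ⁅ u ⁆ ((X ∖ₛ v) ∩ pair u v)
        g y i with memᵇ-⁅x⁆⇒≡ {y = u} {x = y} i
        ... | refl = ∩-i (X ∖ₛ v) (pair y v) y (remove-keeps X v y xu uv) (pair-left y v)

remove-∪-self : ∀ {n} (X : Subset n) v → memᵇ X v ≡ true → (X ∖ₛ v) ∪ ⁅ v ⁆ ≡ X
remove-∪-self X v xv = setext (Sub-∪ {A = X ∖ₛ v} {⁅ v ⁆} {X} (remove-Sub X v) (Sub-⁅x⁆ {W = X} {v} xv)) g
  where g : Sub X ((X ∖ₛ v) ∪ ⁅ v ⁆)
        g y i with y F.≟ v
        ... | yes refl = ∪-r (X ∖ₛ y) ⁅ y ⁆ y (memᵇ-⁅x⁆-self y)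
        ... | no yv = ∪-l (X ∖ₛ v) ⁅ v ⁆ y (remove-keeps X v y i yv)

remove-∩-self : ∀ {n} (X : Subset n) v → (X ∖ₛ v) ∩ ⁅ v ⁆ ≡ ⊥
remove-∩-self X v = setext f (Sub-⊥ {W = (X ∖ₛ v) ∩ ⁅ v ⁆})
  where f : Sub ((X ∖ₛ v) ∩ ⁅ v ⁆) ⊥
        f y i with ∩-e (X ∖ₛ v) ⁅ v ⁆ y i
        ... | a , b with memᵇ-⁅x⁆⇒≡ {y = v} {x = y} b
        ... | refl = absurd (remove-other X y y a refl)

module LeafRemoval {n} (N : BHyp n) where

  Neighbour : Subset n → Fin n → Fin n → Set
  Neighbour X v u = memᵇ X u ≡ true × FrameEdge N v u

  frameEdge-sym : ∀ {a b} → FrameEdge N a b → FrameEdge N b a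
  frameEdge-sym {a} {b} (ne , e) = (λ q → ne (sym q)) , subst (λ Z → Z ∈ₗ edges N) (pair-comm a b) e

  frameEdge-through : ∀ X T v → frameEdgeIn N X T ≡ true → memᵇ T v ≡ true →
    Σ (Fin n) λ w → Neighbour X v w × T ≡ pair v w
  frameEdge-through X T v f i with frameEdge-elim N X T f
  ... | c , s , e with card2⇒pair T c
  ... | a , b , ne , refl with pair-elim a b v i
  ... | inj₁ refl = b , (⊆→Sub s b (pair-right v b) , ne , e) , refl
  ... | inj₂ refl = a , (⊆→Sub s a (pair-left a v) , frameEdge-sym (ne , e)) , pair-comm a v

  frameEdge-remove⇒ : ∀ X v T → frameEdgeIn N X T ≡ true → memᵇ T v ≡ false → frameEdgeIn N (X ∖ₛ v) T ≡ true
  frameEdge-remove⇒ X v T f o with frameEdge-elim N X T f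
  ... | c , s , e = frameEdge-intro N (X ∖ₛ v) T c (Sub→⊆ inside) e
    where
    inside : Sub T (X ∖ₛ v)
    inside y i = remove-keeps X v y (⊆→Sub s y i) (λ { refl → f≢t (trans (sym o) i) })

  frameEdge-remove⇐ : ∀ X v T → frameEdgeIn N (X ∖ₛ v) T ≡ true → frameEdgeIn N X T ≡ true
  frameEdge-remove⇐ X v T = frameEdge-widen N (remove-Sub X v) T

  frameEdge-remove-avoids : ∀ X v T → frameEdgeIn N (X ∖ₛ v) T ≡ true → memᵇ T v ≡ false
  frameEdge-remove-avoids X v T f =
    BP.¬-not (λ i → f≢t (trans (sym (remove-self X v)) (frameEdge-Sub N (X ∖ₛ v) T f v i)))

  frameInd-avoiding : ∀ X v T → memᵇ T v ≡ false → frameInd N X T ≡ frameInd N (X ∖ₛ v) T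
  frameInd-avoiding X v T o = cong boolℚ (bool-ext (λ f → frameEdge-remove⇒ X v T f o) (frameEdge-remove⇐ X v T))

  frameInd-isolated : ∀ X v → (∀ w → ¬ Neighbour X v w) → ∀ T → frameInd N X T ≡ frameInd N (X ∖ₛ v) T
  frameInd-isolated X v iso T with memᵇ T v in eT
  ... | false = frameInd-avoiding X v T eT
  ... | true = cong boolℚ (trans (BP.¬-not (λ f → let (w , nb , _) = frameEdge-through X T v f eT in iso w nb))
                                 (sym (BP.¬-not (λ f → t≢f (trans (sym eT) (frameEdge-remove-avoids X v T f))))))

  frameInd-leaf : ∀ X v u → memᵇ X v ≡ true → Neighbour X v u → (∀ w → Neighbour X v w → w ≡ u) →
    ∀ T → frameInd N X T ≡ frameInd N (X ∖ₛ v) T + 𝟙 (pair u v) T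
  frameInd-leaf X v u xv (xu , vu , e) uniq T with memᵇ T v in eT
  ... | false = trans (frameInd-avoiding X v T eT) (sym (trans (cong (frameInd N (X ∖ₛ v) T +_)
                  (𝟙-diff (λ q → f≢t (trans (sym eT) (trans (cong (λ Z → memᵇ Z v) q) (pair-right u v)))))) (QP.+-identityʳ _)))
  ... | true with T ≟ₛ pair u v
  ... | yes refl = trans (cong boolℚ (frameEdge-intro N X (pair u v) (pair-card u v (λ q → vu (sym q)))
                           (Sub→⊆ (Sub-pair {W = X} {u} {v} xu xv)) (subst (λ Z → Z ∈ₗ edges N) (pair-comm v u) e)))
                   (sym (trans (cong₂ _+_ (cong boolℚ Yf) refl) (QP.+-identityˡ 1ℚ)))
    where Yf : frameEdgeIn N (X ∖ₛ v) (pair u v) ≡ false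
          Yf = BP.¬-not (λ f → t≢f (trans (sym eT) (frameEdge-remove-avoids X v (pair u v) f)))
  ... | no ne = trans (cong boolℚ Xf) (sym (trans (cong₂ _+_ (cong boolℚ Yf) refl) (QP.+-identityˡ 0ℚ)))
    where Yf : frameEdgeIn N (X ∖ₛ v) T ≡ false
          Yf = BP.¬-not (λ f → t≢f (trans (sym eT) (frameEdge-remove-avoids X v T f)))
          Xf : frameEdgeIn N X T ≡ false
          Xf = BP.¬-not (λ f → let (w , nb , q) = frameEdge-through X T v f eT in
                 ne (trans q (trans (cong (pair v) (uniq w nb)) (pair-comm v u))))

  negh-remove-leaf : ∀ (X : Subset n) v u → memᵇ X v ≡ true → memᵇ X u ≡ true → u ≢ v →
    (∀ T → frameInd N X T ≡ frameInd N (X ∖ₛ v) T + 𝟙 (pair u v) T) →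
    ∀ T → - h N X T ≡ - h N (X ∖ₛ v) T + t (X ∖ₛ v) (pair u v) T
  negh-remove-leaf X v u xv xu uv fq T =
    trans (cong -_ (trans (h-split N X T) (cong₂ _+_ (vertexTerm-remove X v xv T)
             (trans (edgeTerm-cong fq T) (trans (edgeTerm-+ (frameInd N (X ∖ₛ v)) (𝟙 (pair u v)) T)
                    (cong (edgeTerm (frameInd N (X ∖ₛ v)) T +_) (edgeTerm-pair u v uv T)))))))
    (sym (trans (cong₂ _+_ (cong -_ (h-split N (X ∖ₛ v) T))
                  (cong₂ (λ A B → 𝟙 A T - 𝟙 (X ∖ₛ v) T - 𝟙 (pair u v) T + 𝟙 B T)
                         (remove-∪-pair X u v xu xv) (remove-∩-pair X u v xu uv)))
      (solve 7 (λ aY gY x y vv p uu → (:- (aY :+ gY)) :+ (x :- y :- p :+ uu)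
                  := :- ((aY :- x :+ y :+ vv) :+ (gY :+ (p :- (uu :+ vv))))) refl
        (vertexTerm (X ∖ₛ v) T) (edgeTerm (frameInd N (X ∖ₛ v)) T) (𝟙 X T) (𝟙 (X ∖ₛ v) T) (𝟙 ⁅ v ⁆ T)
        (𝟙 (pair u v) T) (𝟙 ⁅ u ⁆ T))))

  negh-remove-isolated : ∀ (X : Subset n) v → memᵇ X v ≡ true → (∀ T → frameInd N X T ≡ frameInd N (X ∖ₛ v) T) →
    ∀ T → - h N X T ≡ - h N (X ∖ₛ v) T + (t (X ∖ₛ v) ⁅ v ⁆ T + (- 1ℚ) * 𝟙 ⊥ T)
  negh-remove-isolated X v xv fq T =
    trans (cong -_ (trans (h-split N X T) (cong₂ _+_ (vertexTerm-remove X v xv T) (edgeTerm-cong fq T))))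
    (sym (trans (cong₂ _+_ (cong -_ (h-split N (X ∖ₛ v) T))
                  (cong (_+ (- 1ℚ) * 𝟙 ⊥ T) (cong₂ (λ A B → 𝟙 A T - 𝟙 (X ∖ₛ v) T - 𝟙 ⁅ v ⁆ T + 𝟙 B T)
                         (remove-∪-self X v xv) (remove-∩-self X v))))
      (solve 6 (λ aY gY x y vv z → (:- (aY :+ gY)) :+ ((x :- y :- vv :+ z) :+ (:- con 1ℚ) :* z)
                  := :- ((aY :- x :+ y :+ vv) :+ gY)) refl
        (vertexTerm (X ∖ₛ v) T) (edgeTerm (frameInd N (X ∖ₛ v)) T) (𝟙 X T) (𝟙 (X ∖ₛ v) T) (𝟙 ⁅ v ⁆ T)
        (𝟙 ⊥ T))))

-- A graph without cycles has a vertex of degree ≤ 1: otherwise, walking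
-- along fresh edges from any vertex must revisit a vertex after at most n
-- steps, and the revisited segment of the walk is a cycle in the sense of
-- Defs (a list of ≥ 3 distinct vertices joined cyclically by frame edges).

module CycleSearch {n} (N : BHyp n) where
  open LeafRemoval N

  Neighbour? : ∀ X v u → Dec (Neighbour X v u)
  Neighbour? X v u = (memᵇ X u B.≟ true) ×-dec (¬? (v F.≟ u) ×-dec (pair v u ∈E? N))

  TwoNeighbours : Subset n → Fin n → Set
  TwoNeighbours X v = Σ (Fin n) λ u₁ → Σ (Fin n) λ u₂ → Neighbour X v u₁ × Neighbour X v u₂ × u₁ ≢ u₂

  TwoNeighbours? : ∀ X v → Dec (TwoNeighbours X v)
  TwoNeighbours? X v =
    FP.any? (λ u₁ → FP.any? (λ u₂ → Neighbour? X v u₁ ×-dec (Neighbour? X v u₂ ×-dec ¬? (u₁ F.≟ u₂))))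

  leaf-cases : ∀ X v → ¬ TwoNeighbours X v →
    (∀ w → ¬ Neighbour X v w) ⊎ (Σ (Fin n) λ u → Neighbour X v u × (∀ w → Neighbour X v w → w ≡ u))
  leaf-cases X v nt with FP.any? (Neighbour? X v)
  ... | no ne = inj₁ (λ w nb → ne (w , nb))
  ... | yes (u , nb) = inj₂ (u , nb , λ w nbw → case w nbw)
    where case : ∀ w → Neighbour X v w → w ≡ u
          case w nbw with w F.≟ u
          ... | yes e = e
          ... | no ne = absurd (nt (w , u , nbw , nb , ne))

  NotPrev : Fin n → List (Fin n) → Set
  NotPrev x [] = Unit
  NotPrev x (y ∷ _) = x ≢ y

  choose : ∀ X c rest → TwoNeighbours X c → Σ (Fin n) λ x → Neighbour X c x × NotPrev x rest
  choose X c [] (u₁ , u₂ , nb₁ , nb₂ , ne) = u₁ , nb₁ , tt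
  choose X c (y ∷ rest) (u₁ , u₂ , nb₁ , nb₂ , ne) with u₁ F.≟ y
  ... | yes refl = u₂ , nb₂ , (λ e → ne (sym e))
  ... | no ny = u₁ , nb₁ , ny

  uniq-pre : ∀ (L : List (Fin n)) {M} → Unique (L ++ M) → Unique L
  uniq-pre [] u = []
  uniq-pre (a ∷ L) (h ∷ u) = AllP.++⁻ˡ L h ∷ uniq-pre L u

  uniq-notin : ∀ (L : List (Fin n)) {x M} → Unique (L ++ x ∷ M) → All (x ≢_) L
  uniq-notin [] u = []
  uniq-notin (a ∷ L) (h ∷ u) = (λ e → All.head (AllP.++⁻ʳ L h) (sym e)) ∷ uniq-notin L u

  chain-pre : ∀ a (L M : List (Fin n)) → Chain N ((a ∷ L) ++ M) → Chain N (a ∷ L)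
  chain-pre a [] M ch = tt
  chain-pre a (b ∷ L) M (e , ch) = e , chain-pre b L M ch

  chain-last : ∀ a (L : List (Fin n)) x M → Chain N ((a ∷ L) ++ x ∷ M) → FrameEdge N (lastOf a L) x
  chain-last a [] x M (e , _) = e
  chain-last a (b ∷ L) x M (_ , ch) = chain-last b L x M ch

  listSet : List (Fin n) → Subset n
  listSet [] = ⊥
  listSet (x ∷ xs) = ⁅ x ⁆ ∪ listSet xs

  listSet⇒∈ : ∀ {y} xs → memᵇ (listSet xs) y ≡ true → y ∈ₗ xs
  listSet⇒∈ {y} [] e = absurd (f≢t (trans (sym (memᵇ-⊥ y)) e))
  listSet⇒∈ {y} (x ∷ xs) e with ∪-e ⁅ x ⁆ (listSet xs) y e
  ... | inj₁ i = here (memᵇ-⁅x⁆⇒≡ {y = x} {x = y} i)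
  ... | inj₂ i = there (listSet⇒∈ xs i)

  card-listSet : ∀ xs → Unique xs → ∣ listSet xs ∣ ≡ length xs
  card-listSet [] u = SP.∣⊥∣≡0 n
  card-listSet (x ∷ xs) (h ∷ u) =
    trans (sym (card-remove (listSet (x ∷ xs)) x (∪-l ⁅ x ⁆ (listSet xs) x (memᵇ-⁅x⁆-self x))))
          (cong suc (trans (cong ∣_∣ eq) (card-listSet xs u)))
    where
    eq : listSet (x ∷ xs) ∖ₛ x ≡ listSet xs
    eq = setext f g
      where
      f : Sub (listSet (x ∷ xs) ∖ₛ x) (listSet xs)
      f y e with ∪-e ⁅ x ⁆ (listSet xs) y (remove-Sub (listSet (x ∷ xs)) x y e)
      ... | inj₁ i = absurd (remove-other (listSet (x ∷ xs)) x y e (memᵇ-⁅x⁆⇒≡ {y = x} {x = y} i))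
      ... | inj₂ i = i
      g : Sub (listSet xs) (listSet (x ∷ xs) ∖ₛ x)
      g y e = remove-keeps (listSet (x ∷ xs)) x y (∪-r ⁅ x ⁆ (listSet xs) y e)
                (λ q → All.lookup h (listSet⇒∈ xs e) (sym q))

  unique-length-bound : ∀ xs → Unique xs → length xs ℕ.≤ n
  unique-length-bound xs u = subst (ℕ._≤ n) (card-listSet xs u) (SP.∣p∣≤n (listSet xs))

  -- The walk c ∷ rest (most recent vertex first) steps to x, which it has
  -- already visited: the segment back to x is a cycle.
  extract : ∀ X x c rest → x ∈ₗ (c ∷ rest) → FrameEdge N c x → NotPrev x rest → x ∈ X →
    All (_∈ X) (c ∷ rest) → Unique (c ∷ rest) → Chain N (c ∷ rest) → Cycle N X
  extract X x c rest mem xc np xX al un ch with ∈-∃++ mem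
  ... | [] , zs , refl = absurd (proj₁ xc refl)
  ... | c' ∷ [] , zs , refl = absurd (np refl)
  ... | c' ∷ y₁ ∷ r' , zs , refl =
        x , c , y₁ , r' , (xX ∷ AllP.++⁻ˡ (c ∷ y₁ ∷ r') al) ,
        (uniq-notin (c ∷ y₁ ∷ r') un ∷ uniq-pre (c ∷ y₁ ∷ r') un) ,
        (frameEdge-sym xc , chain-pre c (y₁ ∷ r') (x ∷ zs) ch) , chain-last c (y₁ ∷ r') x zs ch

  walk : ∀ X → (∀ v → memᵇ X v ≡ true → TwoNeighbours X v) → ∀ k c rest → n ℕ.≤ length rest ℕ.+ k →
    All (_∈ X) (c ∷ rest) → Unique (c ∷ rest) → Chain N (c ∷ rest) → Cycle N X
  walk X two zero c rest b al un ch =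
    absurd (NP.<-irrefl refl (NP.≤-trans (unique-length-bound (c ∷ rest) un) (subst (n ℕ.≤_) (NP.+-identityʳ (length rest)) b)))
  walk X two (suc k) c rest b al un ch with choose X c rest (two c (∈⇒memᵇ (All.head al)))
  ... | x , (xX , xc) , np with DMem._∈?_ F._≟_ x (c ∷ rest)
  ... | yes mem = extract X x c rest mem xc np (memᵇ⇒∈ xX) al un ch
  ... | no nm = walk X two k x (c ∷ rest) (subst (n ℕ.≤_) (NP.+-suc (length rest) k) b)
                  (memᵇ⇒∈ xX ∷ al) (AllP.¬Any⇒All¬ (c ∷ rest) nm ∷ un) (frameEdge-sym xc , ch)

module Forests {n} (N : BHyp n) where
  open LeafRemoval N
  open CycleSearch N

  frameInd-⊥ : ∀ T → frameInd N ⊥ T ≡ 0ℚ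
  frameInd-⊥ T = cong boolℚ (BP.¬-not no-edge)
    where
    no-edge : ¬ (frameEdgeIn N ⊥ T ≡ true)
    no-edge f with frameEdge-elim N ⊥ T f
    ... | c , s , e with nonempty T c
    ... | x , i = f≢t (trans (sym (memᵇ-⊥ x)) (⊆→Sub s x i))

  repr-⊥ : Repr N ⊥ (λ T → - h N ⊥ T)
  repr-⊥ = repr-ext negh≡ (repr-∅ 1ℚ)
    where
    no-vertices : ∀ T → sumFin (λ v → memℚ ⊥ v * 𝟙 ⁅ v ⁆ T) ≡ 0ℚ
    no-vertices T = sum-0 (λ v → trans (cong (λ b → boolℚ b * 𝟙 ⁅ v ⁆ T) (memᵇ-⊥ v)) (QP.*-zeroˡ (𝟙 ⁅ v ⁆ T)))
    no-degrees : ∀ T → sumFin (λ v → degreeOf (frameInd N ⊥) v * 𝟙 ⁅ v ⁆ T) ≡ 0ℚ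
    no-degrees T = sum-0 (λ v → trans (cong (_* 𝟙 ⁅ v ⁆ T)
                     (sum-0 (λ u → trans (cong (_* distinctℚ u v) (frameInd-⊥ (pair u v))) (QP.*-zeroˡ (distinctℚ u v)))))
                     (QP.*-zeroˡ (𝟙 ⁅ v ⁆ T)))
    negh≡ : ∀ T → - h N ⊥ T ≡ 1ℚ * 𝟙 ⊥ T
    negh≡ T = trans (cong -_ (trans (h-split N ⊥ T)
                (cong₂ _+_ (cong (- 𝟙 ⊥ T +_) (no-vertices T)) (cong₂ _-_ (frameInd-⊥ T) (no-degrees T)))))
              (solve 1 (λ x → :- ((:- x :+ con 0ℚ) :+ (con 0ℚ :- con 0ℚ)) := con 1ℚ :* x) refl (𝟙 ⊥ T))

  cycle-mono : ∀ X Y → Sub Y X → Cycle N Y → Cycle N X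
  cycle-mono X Y s (a , b , c , r , al , rest) = a , b , c , r , All.map (λ i → memᵇ⇒∈ (s _ (∈⇒memᵇ i))) al , rest

  repr-add-vertex : ∀ X v → memᵇ X v ≡ true → ¬ TwoNeighbours X v →
    Repr N (X ∖ₛ v) (λ T → - h N (X ∖ₛ v) T) → Repr N X (λ T → - h N X T)
  repr-add-vertex X v xv nt rY with leaf-cases X v nt
  ... | inj₁ iso = repr-ext (negh-remove-isolated X v xv (frameInd-isolated X v iso))
      (repr-+ IH (repr-+ (repr-t (X ∖ₛ v) ⁅ v ⁆ sYX (Sub→⊆ (Sub-⁅x⁆ {W = X} {v} xv))) (repr-∅ (- 1ℚ))))
    where
    sYX : X ∖ₛ v ⊆ X
    sYX = Sub→⊆ (remove-Sub X v)
    IH : Repr N X (λ T → - h N (X ∖ₛ v) T)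
    IH = repr-widen sYX rY
  ... | inj₂ (u , nb , uniq) =
      repr-ext (negh-remove-leaf X v u xv (proj₁ nb) (λ q → proj₁ (proj₂ nb) (sym q)) (frameInd-leaf X v u xv nb uniq))
        (repr-+ IH (repr-t (X ∖ₛ v) (pair u v) sYX (Sub→⊆ (Sub-pair {W = X} {u} {v} (proj₁ nb) xv))))
    where
    sYX : X ∖ₛ v ⊆ X
    sYX = Sub→⊆ (remove-Sub X v)
    IH : Repr N X (λ T → - h N (X ∖ₛ v) T)
    IH = repr-widen sYX rY

  low-degree-vertex : ∀ X x₀ → memᵇ X x₀ ≡ true → ¬ Cycle N X →
    Σ (Fin n) λ v → memᵇ X v ≡ true × ¬ TwoNeighbours X v
  low-degree-vertex X x₀ i₀ nc with FP.any? (λ v → (memᵇ X v B.≟ true) ×-dec ¬? (TwoNeighbours? X v))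
  ... | yes found = found
  ... | no none = absurd (nc (walk X two n x₀ [] NP.≤-refl (memᵇ⇒∈ i₀ ∷ []) ([] ∷ []) tt))
    where two : ∀ v → memᵇ X v ≡ true → TwoNeighbours X v
          two v xv with TwoNeighbours? X v
          ... | yes t2 = t2
          ... | no nt = absurd (none (v , xv , nt))

  forest-repr-bounded : ∀ k (X : Subset n) → ∣ X ∣ ℕ.< k → ¬ Cycle N X → Repr N X (λ T → - h N X T)
  forest-repr-bounded (suc k) X lt nc with SP.nonempty? X
  ... | no ne = subst (λ Z → Repr N Z (λ T → - h N Z T)) (sym (SP.Empty-unique ne)) repr-⊥
  ... | yes (x₀ , i₀) with low-degree-vertex X x₀ (∈⇒memᵇ i₀) nc
  ... | v , xv , nt = repr-add-vertex X v xv nt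
          (forest-repr-bounded k (X ∖ₛ v) (subst (ℕ._≤ k) (sym (card-remove X v xv)) (NP.≤-pred lt))
                               (λ c → nc (cycle-mono X (X ∖ₛ v) (remove-Sub X v) c)))

  forest-repr : ∀ X → SpansForest N X → Repr N X (λ T → - h N X T)
  forest-repr X nc = forest-repr-bounded (suc ∣ X ∣) X NP.≤-refl nc

module Reflection {n m} {N : BHyp n} {M' : BHyp m} {L X : Subset n} {τ₁ τ₂ : Fin n → Fin m}
                  (R : IsReflection N L X τ₁ τ₂ M') (XL : X ⊆ L) where
  open IsReflection R
  open DisjUnion vertices

  τ₁-injOn : ∀ W → InjOn τ₁ W
  τ₁-injOn = injOn-everywhere τ₁ τ₁-inj

  τ₂-injOn : ∀ W → Sub W L → InjOn τ₂ W
  τ₂-injOn W s u v a b e = τ₂-inj u v (memᵇ⇒∈ {S = L} (s u a)) (memᵇ⇒∈ {S = L} (s v b)) e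

  sXL : Sub X L
  sXL = ⊆→Sub XL

  glue⇒ : ∀ v l → memᵇ L l ≡ true → τ₁ v ≡ τ₂ l → v ≡ l × memᵇ X l ≡ true
  glue⇒ v l lL e with Equivalence.to (glue v l (memᵇ⇒∈ {S = L} lL)) e
  ... | p , q = p , ∈⇒memᵇ q

  glue⇐ : ∀ x → memᵇ X x ≡ true → τ₁ x ≡ τ₂ x
  glue⇐ x xX = Equivalence.from (glue x x (memᵇ⇒∈ {S = L} (sXL x xX))) (refl , memᵇ⇒∈ {S = X} xX)

  τ₂≡τ₁-on-X : ∀ S → Sub S X → image τ₂ S ≡ image τ₁ S
  τ₂≡τ₁-on-X S s = setext f g
    where
    f : Sub (image τ₂ S) (image τ₁ S)
    f w e with image-elim τ₂ S w e
    ... | v , i , refl = subst (λ z → memᵇ (image τ₁ S) z ≡ true) (glue⇐ v (s v i)) (image-intro τ₁ S v i)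
    g : Sub (image τ₁ S) (image τ₂ S)
    g w e with image-elim τ₁ S w e
    ... | v , i , refl = subst (λ z → memᵇ (image τ₂ S) z ≡ true) (sym (glue⇐ v (s v i))) (image-intro τ₂ S v i)

  τ₁-in-τ₂-image : ∀ S v → Sub S L → memᵇ (image τ₂ S) (τ₁ v) ≡ true → memᵇ X v ≡ true × memᵇ S v ≡ true
  τ₁-in-τ₂-image S v sL e with image-elim τ₂ S (τ₁ v) e
  ... | l , i , q with glue⇒ v l (sL l i) (sym q)
  ... | refl , x = x , i

  τ₂-in-τ₁-image : ∀ S l → memᵇ L l ≡ true → memᵇ (image τ₁ S) (τ₂ l) ≡ true → memᵇ X l ≡ true × memᵇ S l ≡ true
  τ₂-in-τ₁-image S l lL e with image-elim τ₁ S (τ₂ l) e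
  ... | v , i , q with glue⇒ v l lL q
  ... | refl , x = x , i

  τ₁-reflects : ∀ A v → memᵇ (image τ₁ A) (τ₁ v) ≡ true → memᵇ A v ≡ true
  τ₁-reflects A v e = image-reflects τ₁ ⊤ (τ₁-injOn ⊤) A v (Sub-⊤ {W = A}) (memᵇ-⊤ v) e

  τ₂-reflects : ∀ A l → Sub A L → memᵇ L l ≡ true → memᵇ (image τ₂ A) (τ₂ l) ≡ true → memᵇ A l ≡ true
  τ₂-reflects A l sA lL e = image-reflects τ₂ L (τ₂-injOn L (Sub-refl {A = L})) A l sA lL e

  edge-τ₁ : ∀ S → S ∈ₗ edges N → image τ₁ S ∈ₗ edges M'
  edge-τ₁ S e = Equivalence.from (edges-spec (image τ₁ S)) (inj₁ (S , e , refl))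

  edge-τ₂ : ∀ S → S ∈ₗ edges N → S ⊆ L → image τ₂ S ∈ₗ edges M'
  edge-τ₂ S e s = Equivalence.from (edges-spec (image τ₂ S)) (inj₂ (inj₁ (S , e , s , refl)))

  edge-glued : ∀ A C → GoodPair N L X A C → image τ₁ A ∪ image τ₂ C ∈ₗ edges M'
  edge-glued A C g = Equivalence.from (edges-spec (image τ₁ A ∪ image τ₂ C)) (inj₂ (inj₂ (A , C , g , refl)))

  rel-τ₁ : ∀ A C → (A , C) ∈ₗ rel N → (image τ₁ A , image τ₁ C) ∈ₗ rel M'
  rel-τ₁ A C r = Equivalence.from (rel-spec (image τ₁ A) (image τ₁ C)) (inj₁ (A , C , r , refl , refl))

  rel-τ₂ : ∀ A C → (A , C) ∈ₗ rel N → A ⊆ L → C ⊆ L → (image τ₂ A , image τ₂ C) ∈ₗ rel M'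
  rel-τ₂ A C r a c = Equivalence.from (rel-spec (image τ₂ A) (image τ₂ C)) (inj₂ (inj₁ (A , C , r , a , c , refl , refl)))

  rel-glued : ∀ A C → GoodPair N L X A C → (image τ₁ A , image τ₂ C) ∈ₗ rel M'
  rel-glued A C g = Equivalence.from (rel-spec (image τ₁ A) (image τ₂ C)) (inj₂ (inj₂ (A , C , g , inj₁ (refl , refl))))

  collapse-τ₂X : ∀ A → Sub X A → image τ₁ A ∪ image τ₂ X ≡ image τ₁ A
  collapse-τ₂X A sXA = trans (cong (image τ₁ A ∪_) (τ₂≡τ₁-on-X X (Sub-refl {A = X})))
                    (trans (sym (image-∪ τ₁ A X))
                           (cong (image τ₁) (setext (Sub-∪ {A = A} {X} {A} (Sub-refl {A = A}) sXA) (∪-l A X))))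

  collapse-τ₁X : ∀ C → Sub X C → image τ₁ X ∪ image τ₂ C ≡ image τ₂ C
  collapse-τ₁X C sXC = trans (cong (_∪ image τ₂ C) (sym (τ₂≡τ₁-on-X X (Sub-refl {A = X}))))
                    (trans (sym (image-∪ τ₂ X C))
                           (cong (image τ₂) (setext (Sub-∪ {A = X} {C} {C} sXC (Sub-refl {A = C})) (∪-r X C))))

  X⊆left : ∀ {A C} → X ⊆ A ∩ C → Sub X A
  X⊆left {A} {C} xac x e = proj₁ (∩-e A C x (⊆→Sub xac x e))

  X⊆right : ∀ {A C} → X ⊆ A ∩ C → Sub X C
  X⊆right {A} {C} xac x e = proj₂ (∩-e A C x (⊆→Sub xac x e))

  -- The frame of τ₁ K in r_{L,X}(N) is the τ₁-image of the frame of K in N: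
  -- every 2-element edge of r_{L,X}(N) inside τ₁ K is (or collapses to) τ₁ S
  -- for a 2-element edge S ⊆ K of N.
  frameEdge-from-τ₁ : ∀ K S T' → S ∈ₗ edges N → T' ≡ image τ₁ S → ∣ T' ∣ ≡ 2 → Sub T' (image τ₁ K) →
       ImageOf τ₁ (frameEdgeIn N K) T'
  frameEdge-from-τ₁ K S T' e refl c s = S , frameEdge-intro N K S (card2-preimage τ₁ S (τ₁-injOn S) c)
      (Sub→⊆ (λ v i → τ₁-reflects K v (s (τ₁ v) (image-intro τ₁ S v i)))) e , refl

  frame-τ₁⇒ : ∀ K T' → frameEdgeIn M' (image τ₁ K) T' ≡ true → ImageOf τ₁ (frameEdgeIn N K) T'
  frame-τ₁⇒ K T' fe' with frameEdge-elim M' (image τ₁ K) T' fe'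
  ... | c2 , sT , mem with Equivalence.to (edges-spec T') mem
  ... | inj₁ (S , e , refl) = frameEdge-from-τ₁ K S _ e refl c2 (⊆→Sub sT)
  ... | inj₂ (inj₁ (S , e , sL , refl)) = frameEdge-from-τ₁ K S _ e (τ₂≡τ₁-on-X S sSX) c2 (⊆→Sub sT)
    where
    sSX : Sub S X
    sSX l i = proj₁ (τ₂-in-τ₁-image K l (⊆→Sub sL l i) (⊆→Sub sT (τ₂ l) (image-intro τ₂ S l i)))
  ... | inj₂ (inj₂ (A , C , (aE , cE , cL , xac) , refl)) =
        frameEdge-from-τ₁ K A _ aE (trans (cong (λ Z → image τ₁ A ∪ image τ₂ Z) CX) (collapse-τ₂X A (X⊆left {A} {C} xac)))
                          c2 (⊆→Sub sT)
    where
    sCX : Sub C X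
    sCX l i = proj₁ (τ₂-in-τ₁-image K l (⊆→Sub cL l i) (⊆→Sub sT (τ₂ l) (∪-r (image τ₁ A) (image τ₂ C) (τ₂ l) (image-intro τ₂ C l i))))
    CX : C ≡ X
    CX = setext sCX (X⊆right {A} {C} xac)

  frame-τ₁⇐ : ∀ K T' → ImageOf τ₁ (frameEdgeIn N K) T' → frameEdgeIn M' (image τ₁ K) T' ≡ true
  frame-τ₁⇐ K T' (S , f , refl) with frameEdge-elim N K S f
  ... | c , s , e = frameEdge-intro M' (image τ₁ K) (image τ₁ S) (card2-image τ₁ S (τ₁-injOn S) c)
                      (Sub→⊆ (image-mono τ₁ (⊆→Sub s))) (edge-τ₁ S e)

  frameInd-τ₁ : ∀ K T' → frameInd M' (image τ₁ K) T' ≡ push τ₁ K (frameInd N K) T'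
  frameInd-τ₁ K T' with push-bool τ₁ K (τ₁-injOn K) (frameEdgeIn N K) (frameEdge-Sub N K) T'
  ... | β , pe , f , g = trans (cong boolℚ (bool-ext-via β (frame-τ₁⇒ K T') (frame-τ₁⇐ K T') f g)) (sym pe)

  frameEdge-from-τ₂ : ∀ K S T' → Sub K L → S ∈ₗ edges N → Sub S L → T' ≡ image τ₂ S → ∣ T' ∣ ≡ 2 →
       Sub T' (image τ₂ K) → ImageOf τ₂ (frameEdgeIn N K) T'
  frameEdge-from-τ₂ K S T' sK e sS refl c s = S , frameEdge-intro N K S (card2-preimage τ₂ S (τ₂-injOn S sS) c)
      (Sub→⊆ (λ v i → τ₂-reflects K v sK (sS v i) (s (τ₂ v) (image-intro τ₂ S v i)))) e , refl

  frame-τ₂⇒ : ∀ K → Sub K L → ∀ T' → frameEdgeIn M' (image τ₂ K) T' ≡ true → ImageOf τ₂ (frameEdgeIn N K) T'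
  frame-τ₂⇒ K sK T' fe' with frameEdge-elim M' (image τ₂ K) T' fe'
  ... | c2 , sT , mem with Equivalence.to (edges-spec T') mem
  ... | inj₁ (S , e , refl) = frameEdge-from-τ₂ K S _ sK e (Sub-trans {A = S} {X} {L} sSX sXL) (sym (τ₂≡τ₁-on-X S sSX)) c2 (⊆→Sub sT)
    where
    sSX : Sub S X
    sSX v i = proj₁ (τ₁-in-τ₂-image K v sK (⊆→Sub sT (τ₁ v) (image-intro τ₁ S v i)))
  ... | inj₂ (inj₁ (S , e , sL , refl)) = frameEdge-from-τ₂ K S _ sK e (⊆→Sub sL) refl c2 (⊆→Sub sT)
  ... | inj₂ (inj₂ (A , C , (aE , cE , cL , xac) , refl)) =
        frameEdge-from-τ₂ K C _ sK cE (⊆→Sub cL)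
          (trans (cong (λ Z → image τ₁ Z ∪ image τ₂ C) AX) (collapse-τ₁X C (X⊆right {A} {C} xac))) c2 (⊆→Sub sT)
    where
    sAX : Sub A X
    sAX v i = proj₁ (τ₁-in-τ₂-image K v sK (⊆→Sub sT (τ₁ v) (∪-l (image τ₁ A) (image τ₂ C) (τ₁ v) (image-intro τ₁ A v i))))
    AX : A ≡ X
    AX = setext sAX (X⊆left {A} {C} xac)

  frame-τ₂⇐ : ∀ K → Sub K L → ∀ T' → ImageOf τ₂ (frameEdgeIn N K) T' → frameEdgeIn M' (image τ₂ K) T' ≡ true
  frame-τ₂⇐ K sK T' (S , f , refl) with frameEdge-elim N K S f
  ... | c , s , e = frameEdge-intro M' (image τ₂ K) (image τ₂ S) (card2-image τ₂ S (τ₂-injOn S sSL) c)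
                      (Sub→⊆ (image-mono τ₂ (⊆→Sub s))) (edge-τ₂ S e (Sub→⊆ sSL))
    where sSL : Sub S L
          sSL = Sub-trans {A = S} {K} {L} (⊆→Sub s) sK

  frameInd-τ₂ : ∀ K → Sub K L → ∀ T' → frameInd M' (image τ₂ K) T' ≡ push τ₂ K (frameInd N K) T'
  frameInd-τ₂ K sK T' with push-bool τ₂ K (τ₂-injOn K sK) (frameEdgeIn N K) (frameEdge-Sub N K) T'
  ... | β , pe , f , g = trans (cong boolℚ (bool-ext-via β (frame-τ₂⇒ K sK T') (frame-τ₂⇐ K sK T') f g)) (sym pe)

  h-τ₁ : ∀ K T' → h M' (image τ₁ K) T' ≡ push τ₁ K (h N K) T'
  h-τ₁ K = h-image N M' τ₁ K (τ₁-injOn K) (frameInd-τ₁ K)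

  h-τ₂ : ∀ K → Sub K L → ∀ T' → h M' (image τ₂ K) T' ≡ push τ₂ K (h N K) T'
  h-τ₂ K sK = h-image N M' τ₂ K (τ₂-injOn K sK) (frameInd-τ₂ K sK)

  repr-τ₁ : ∀ K {f} → Repr N K f → Repr M' (image τ₁ K) (push τ₁ K f)
  repr-τ₁ K = repr-push τ₁ K (τ₁-injOn K) (λ A C r _ _ → rel-τ₁ A C r)

  repr-τ₂ : ∀ K → K ⊆ L → ∀ {f} → Repr N K f → Repr M' (image τ₂ K) (push τ₂ K f)
  repr-τ₂ K kL = repr-push τ₂ K (τ₂-injOn K (⊆→Sub kL))
                   (λ A C r a c → rel-τ₂ A C r (SP.⊆-trans a kL) (SP.⊆-trans c kL))

  repr-h-τ₁ : ∀ K → Repr N K (h N K) → Repr M' (image τ₁ K) (h M' (image τ₁ K))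
  repr-h-τ₁ K r = repr-ext (h-τ₁ K) (repr-τ₁ K r)

  repr-h-τ₂ : ∀ K → K ⊆ L → Repr N K (h N K) → Repr M' (image τ₂ K) (h M' (image τ₂ K))
  repr-h-τ₂ K kL r = repr-ext (h-τ₂ K (⊆→Sub kL)) (repr-τ₂ K kL r)

  repr-negh-τ₁ : ∀ K → Repr N K (λ T → - h N K T) → Repr M' (image τ₁ K) (λ T' → - h M' (image τ₁ K) T')
  repr-negh-τ₁ K r = repr-ext (λ T' → trans (cong -_ (h-τ₁ K T')) (sym (push-neg τ₁ K (h N K) T'))) (repr-τ₁ K r)

  module Glued (ns : NoSingleton N) {K₁ K₂ : Subset n} (gp : GoodPair N L X K₁ K₂) where
    K' : Subset m
    K' = image τ₁ K₁ ∪ image τ₂ K₂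

    sK₂L : Sub K₂ L
    sK₂L = ⊆→Sub (proj₁ (proj₂ (proj₂ gp)))

    sXK₁ : Sub X K₁
    sXK₁ = X⊆left {K₁} {K₂} (proj₂ (proj₂ (proj₂ gp)))

    sXK₂ : Sub X K₂
    sXK₂ = X⊆right {K₁} {K₂} (proj₂ (proj₂ (proj₂ gp)))

    -- A τ₁-image inside K' lies in τ₁K₁ (the part in τ₂K₂ is in τ₁X ⊆ τ₁K₁).
    τ₁-part : ∀ S → Sub (image τ₁ S) K' → Sub (image τ₁ S) (image τ₁ K₁)
    τ₁-part S s w e with image-elim τ₁ S w e
    ... | v , i , refl with ∪-e (image τ₁ K₁) (image τ₂ K₂) (τ₁ v) (s (τ₁ v) e)
    ... | inj₁ a = a
    ... | inj₂ b = image-intro τ₁ K₁ v (sXK₁ v (proj₁ (τ₁-in-τ₂-image K₂ v sK₂L b)))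

    τ₂-part : ∀ S → Sub S L → Sub (image τ₂ S) K' → Sub (image τ₂ S) (image τ₂ K₂)
    τ₂-part S sS s w e with image-elim τ₂ S w e
    ... | l , i , refl with ∪-e (image τ₁ K₁) (image τ₂ K₂) (τ₂ l) (s (τ₂ l) e)
    ... | inj₁ a = image-intro τ₂ K₂ l (sXK₂ l (proj₁ (τ₂-in-τ₁-image K₁ l (sS l i) a)))
    ... | inj₂ b = b

    -- For a
    -- glued 2-element edge τ₁A ∪ τ₂C this is where no edge being a singleton
    -- is used: if neither A ⊆ X nor C ⊆ X, it would have three elements.
    frameEdge-split : ∀ T' → T' ∈ₗ edges M' → ∣ T' ∣ ≡ 2 → Sub T' K' →
      Sub T' (image τ₁ K₁) ⊎ Sub T' (image τ₂ K₂)
    frameEdge-split T' mem c2 sT with Equivalence.to (edges-spec T') mem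
    ... | inj₁ (S , e , refl) = inj₁ (τ₁-part S sT)
    ... | inj₂ (inj₁ (S , e , sL , refl)) = inj₂ (τ₂-part S (⊆→Sub sL) sT)
    ... | inj₂ (inj₂ (A , C , (aE , cE , cL , xac) , refl)) with sub-dec C X
    ... | inj₁ sCX = inj₁ (subst (λ Z → Sub Z (image τ₁ K₁)) (sym τ₁A) (τ₁-part A (subst (λ Z → Sub Z K') τ₁A sT)))
      where
      τ₁A : image τ₁ A ∪ image τ₂ C ≡ image τ₁ A
      τ₁A = trans (cong (λ Z → image τ₁ A ∪ image τ₂ Z) (setext sCX (X⊆right {A} {C} xac)))
                  (collapse-τ₂X A (X⊆left {A} {C} xac))
    ... | inj₂ (b , bC , bnX) with sub-dec A X
    ... | inj₁ sAX = inj₂ (subst (λ Z → Sub Z (image τ₂ K₂)) (sym τ₂C)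
                                 (τ₂-part C (⊆→Sub cL) (subst (λ Z → Sub Z K') τ₂C sT)))
      where
      τ₂C : image τ₁ A ∪ image τ₂ C ≡ image τ₂ C
      τ₂C = trans (cong (λ Z → image τ₁ Z ∪ image τ₂ C) (setext sAX (X⊆left {A} {C} xac)))
                  (collapse-τ₁X C (X⊆right {A} {C} xac))
    ... | inj₂ (a , aA , anX) with ns A aE a aA
    ... | c , cA , ca = absurd (no-three-in-pair (image τ₁ A ∪ image τ₂ C) (τ₁ a) (τ₁ c) (τ₂ b)
            (∪-l (image τ₁ A) (image τ₂ C) (τ₁ a) (image-intro τ₁ A a aA))
            (∪-l (image τ₁ A) (image τ₂ C) (τ₁ c) (image-intro τ₁ A c cA))
            (∪-r (image τ₁ A) (image τ₂ C) (τ₂ b) (image-intro τ₂ C b bC))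
            (λ e → ca (sym (τ₁-inj a c e)))
            (λ e → t≢f (trans (sym (proj₂ (glue⇒ a b (⊆→Sub cL b bC) e))) bnX))
            (λ e → t≢f (trans (sym (proj₂ (glue⇒ c b (⊆→Sub cL b bC) e))) bnX))
            c2)

    cap : image τ₁ K₁ ∩ image τ₂ K₂ ≡ image τ₁ X
    cap = setext to from
      where
      to : Sub (image τ₁ K₁ ∩ image τ₂ K₂) (image τ₁ X)
      to w e with ∩-e (image τ₁ K₁) (image τ₂ K₂) w e
      ... | a , b with image-elim τ₁ K₁ w a
      ... | v , vK , refl = image-intro τ₁ X v (proj₁ (τ₁-in-τ₂-image K₂ v sK₂L b))
      from : Sub (image τ₁ X) (image τ₁ K₁ ∩ image τ₂ K₂)
      from w e with image-elim τ₁ X w e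
      ... | x , xX , refl = ∩-i (image τ₁ K₁) (image τ₂ K₂) (τ₁ x) (image-intro τ₁ K₁ x (sXK₁ x xX))
                              (subst (λ z → memᵇ (image τ₂ K₂) z ≡ true) (sym (glue⇐ x xX))
                                     (image-intro τ₂ K₂ x (sXK₂ x xX)))

    h-glued : ∀ T' → h M' K' T' ≡ h M' (image τ₁ K₁) T' + h M' (image τ₂ K₂) T' - h M' (image τ₁ X) T'
                                   - t (image τ₁ K₁) (image τ₂ K₂) T'
    h-glued = h-∪ M' (image τ₁ K₁) (image τ₂ K₂) (image τ₁ X) cap
      (λ T' → trans (frameInd-∪ M' (image τ₁ K₁) (image τ₂ K₂) frameEdge-split T')
                    (cong (λ Z → frameInd M' (image τ₁ K₁) T' + frameInd M' (image τ₂ K₂) T' - frameInd M' Z T') cap))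

    repr-h-glued : Repr N K₁ (h N K₁) → Repr N K₂ (h N K₂) → Repr N X (λ T → - h N X T) → Repr M' K' (h M' K')
    repr-h-glued r₁ r₂ rX = repr-ext h-glued (repr-+ (repr-+ (repr-+ part₁ part₂) partX) partt)
      where
      s₁ : image τ₁ K₁ ⊆ K'
      s₁ = Sub→⊆ (∪-l (image τ₁ K₁) (image τ₂ K₂))
      s₂ : image τ₂ K₂ ⊆ K'
      s₂ = Sub→⊆ (∪-r (image τ₁ K₁) (image τ₂ K₂))
      part₁ : Repr M' K' (h M' (image τ₁ K₁))
      part₁ = repr-widen s₁ (repr-h-τ₁ K₁ r₁)
      part₂ : Repr M' K' (h M' (image τ₂ K₂))
      part₂ = repr-widen s₂ (repr-h-τ₂ K₂ (Sub→⊆ sK₂L) r₂)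
      partX : Repr M' K' (λ T' → - h M' (image τ₁ X) T')
      partX = repr-widen (SP.⊆-trans (image-⊆ τ₁ (Sub→⊆ sXK₁)) s₁) (repr-negh-τ₁ X rX)
      partt : Repr M' K' (λ T' → - t (image τ₁ K₁) (image τ₂ K₂) T')
      partt = repr-ext (λ T' → solve 1 (λ x → :- x := (:- con 1ℚ) :* x) refl (t (image τ₁ K₁) (image τ₂ K₂) T'))
                       (repr-rel (- 1ℚ) (image τ₁ K₁) (image τ₂ K₂) (rel-glued K₁ K₂ gp) s₁ s₂)

record Invariant {n} (M : BHyp n) : Set where
  field
    edges-repr   : ∀ K → K ∈ₗ edges M → Repr M K (h M K)
    no-singleton : NoSingleton M
    full-edge    : ⊤ ∈ₗ edges M

invariant-base : Invariant trivialComplex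
invariant-base = record { edges-repr = edges-repr ; no-singleton = no-singleton ; full-edge = here refl }
  where
  edges-repr : ∀ K → K ∈ₗ edges trivialComplex → Repr trivialComplex K (h trivialComplex K)
  edges-repr K (here refl) = repr-ext h-trivial (repr-∅ 0ℚ)
    where
    h-trivial : ∀ T → h trivialComplex ⊤ T ≡ 0ℚ * 𝟙 ⊥ T
    h-trivial (false V.∷ false V.∷ V.[]) = refl
    h-trivial (false V.∷ true V.∷ V.[]) = refl
    h-trivial (true V.∷ false V.∷ V.[]) = refl
    h-trivial (true V.∷ true V.∷ V.[]) = refl

  no-singleton : NoSingleton trivialComplex
  no-singleton K (here refl) zero _ = suc zero , refl , (λ ())
  no-singleton K (here refl) (suc zero) _ = zero , refl , (λ ())

noSingleton-image : ∀ {n m} {N : BHyp n} (τ : Fin n → Fin m) W → InjOn τ W → NoSingleton N →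
  ∀ K → K ∈ₗ edges N → Sub K W → ∀ w → memᵇ (image τ K) w ≡ true →
  ∃ λ c → memᵇ (image τ K) c ≡ true × c ≢ w
noSingleton-image τ W inj ns K kE sKW w e with image-elim τ K w e
... | a , aK , refl with ns K kE a aK
... | c , cK , ca = τ c , image-intro τ K c cK , (λ q → ca (inj c a (sKW c cK) (sKW a aK) q))

module Step {n m} {N : BHyp n} {M' : BHyp m} {L X : Subset n} {τ₁ τ₂ : Fin n → Fin m}
            (R : IsReflection N L X τ₁ τ₂ M') (XL : X ⊆ L) (L∈E : L ∈ₗ edges N) (forest : SpansForest N X)
            (inv : Invariant N) where
  open IsReflection R
  open DisjUnion vertices
  open Reflection R XL
  open Invariant inv

  edges-repr′ : ∀ K' → K' ∈ₗ edges M' → Repr M' K' (h M' K')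
  edges-repr′ K' mem with Equivalence.to (edges-spec K') mem
  ... | inj₁ (K , kE , refl) = repr-h-τ₁ K (edges-repr K kE)
  ... | inj₂ (inj₁ (K , kE , kL , refl)) = repr-h-τ₂ K kL (edges-repr K kE)
  ... | inj₂ (inj₂ (K₁ , K₂ , gp , refl)) =
        Glued.repr-h-glued no-singleton gp (edges-repr K₁ (proj₁ gp)) (edges-repr K₂ (proj₁ (proj₂ gp)))
                           (Forests.forest-repr N X forest)

  no-singleton-τ₁ : ∀ K → K ∈ₗ edges N → ∀ w → memᵇ (image τ₁ K) w ≡ true →
    ∃ λ c → memᵇ (image τ₁ K) c ≡ true × c ≢ w
  no-singleton-τ₁ K kE = noSingleton-image {N = N} τ₁ ⊤ (τ₁-injOn ⊤) no-singleton K kE (Sub-⊤ {W = K})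

  no-singleton-τ₂ : ∀ K → K ∈ₗ edges N → K ⊆ L → ∀ w → memᵇ (image τ₂ K) w ≡ true →
    ∃ λ c → memᵇ (image τ₂ K) c ≡ true × c ≢ w
  no-singleton-τ₂ K kE kL = noSingleton-image {N = N} τ₂ L (τ₂-injOn L (Sub-refl {A = L})) no-singleton K kE (⊆→Sub kL)

  no-singleton′ : NoSingleton M'
  no-singleton′ K' mem w e with Equivalence.to (edges-spec K') mem
  ... | inj₁ (K , kE , refl) = no-singleton-τ₁ K kE w e
  ... | inj₂ (inj₁ (K , kE , kL , refl)) = no-singleton-τ₂ K kE kL w e
  ... | inj₂ (inj₂ (A , C , (aE , cE , cL , _) , refl)) with ∪-e (image τ₁ A) (image τ₂ C) w e
  ... | inj₁ a = let (c , ci , cw) = no-singleton-τ₁ A aE w a in c , ∪-l (image τ₁ A) (image τ₂ C) c ci , cw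
  ... | inj₂ b = let (c , ci , cw) = no-singleton-τ₂ C cE cL w b in c , ∪-r (image τ₁ A) (image τ₂ C) c ci , cw

  -- V' = τ₁(V) ∪ τ₂(L) is the glued edge of the good pair (V, L).
  full-edge′ : ⊤ ∈ₗ edges M'
  full-edge′ = subst (λ Z → Z ∈ₗ edges M') cover-⊤
                 (edge-glued ⊤ L (full-edge , L∈E , (λ i → i) , Sub→⊆ (λ x e → ∩-i ⊤ L x (memᵇ-⊤ x) (sXL x e))))
    where
    cover-⊤ : image τ₁ ⊤ ∪ image τ₂ L ≡ ⊤
    cover-⊤ = setext (Sub-⊤ {W = image τ₁ ⊤ ∪ image τ₂ L}) covered
      where
      covered : Sub ⊤ (image τ₁ ⊤ ∪ image τ₂ L)
      covered w _ with cover w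
      ... | inj₁ (v , refl) = ∪-l (image τ₁ ⊤) (image τ₂ L) (τ₁ v) (image-intro τ₁ ⊤ v (memᵇ-⊤ v))
      ... | inj₂ (l , lL , refl) = ∪-r (image τ₁ ⊤) (image τ₂ L) (τ₂ l) (image-intro τ₂ L l (∈⇒memᵇ lL))

  invariant′ : Invariant M'
  invariant′ = record { edges-repr = edges-repr′ ; no-singleton = no-singleton′ ; full-edge = full-edge′ }

invariant : ∀ {n} (M : BHyp n) → InC M → Invariant M
invariant _ base = invariant-base
invariant M (reflect L X τ₁ τ₂ c L∈E XL forest R) = Step.invariant′ R XL L∈E forest (invariant _ c)

theorem6p9 : ∀ {n} (M : BHyp n) → InC M →
    (∀ (K : Subset n) → K ∈ₗ edges M → ThickOn M K) × Thick M
theorem6p9 M c = (λ K k → repr⇒thick M K (edges-repr K k)) , repr⇒thick M ⊤ (edges-repr ⊤ full-edge)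
  where open Invariant (invariant M c)
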